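{- (Truth Lemma) Let $\mathfrak{J}^c=\langle W^c,\mathcal{A}^c,\{R^c_{/\phi/}:/\phi/\in\mathcal{A}^c\},V\rangle$ be the canonical model for $\mathbf{LCR}$, with $V$ extended to all formulae by the Kripke clauses below (using $R^c_{/\phi/}$ for the $\succ$-clause). Then for every formula $\phi$, every $x\in W^c$ and every $a\in\mathcal{T}$: $V_x(\phi)=a$ if and only if $\mathbf{J}_a(\phi)\in x$.
   Context: Fix an integer $m\ge 2$ and let $\mathcal{T}=\{0,\frac{1}{m-1},\dots,\frac{m-2}{m-1},1\}$ with its natural order. For $a,b\in\mathcal{T}$ put $\sim a=1-a$, $a\rightarrow b=\min\{1,1-a+b\}$, $a\odot b=\max\{0,a+b-1\}$. The language $\mathcal{L}_{\succ}$ has a countable set $\Pi$ of propositional variables, the unary connective $\neg$ and the binary connectives $\rightarrow$ and $\succ$. Abbreviations: $\mathbf{t}:=p\rightarrow p$ (for a fixed variable $p$), $\phi\vee\psi:=(\phi\rightarrow\psi)\rightarrow\psi$, $\phi\wedge\psi:=\neg(\neg\phi\vee\neg\psi)$, $\phi\leftrightarrow\psi:=(\phi\rightarrow\psi)\wedge(\psi\rightarrow\phi)$. For $a\in\mathcal{T}$, $\mathbf{J}_a(\phi)$ is a fixed formula built from $\phi$ with $\neg,\rightarrow$ (the Rosser–Turquette $J$-operator of Łukasiewicz $m$-valued logic) whose value is $1$ if the value of $\phi$ is $a$ and $0$ otherwise; $\mathbf{I}_a(\phi):=\mathbf{J}_a(\phi)\vee\dots\vee\mathbf{J}_1(\phi)$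 (disjunction over all $b\in\mathcal{T}$ with $b\ge a$). Iterated implication: $\rightarrow_{i=1}^{0}(\phi_i,\psi):=\psi$, $\rightarrow_{i=1}^{k}(\phi_i,\psi):=\phi_k\rightarrow(\rightarrow_{i=1}^{k-1}(\phi_i,\psi))$. Kripke clauses: $V_x(\neg\phi)=\sim V_x(\phi)$, $V_x(\phi\rightarrow\psi)=V_x(\phi)\rightarrow V_x(\psi)$, $V_x(\phi\succ\psi)=\bigwedge\{xR^c_{/\phi/}y\rightarrow V_y(\psi):y\in W^c\}$. The system $\mathbf{LCR}$: all $\mathcal{L}_{\succ}$-instances of the axioms of a (complete) axiomatization of Łukasiewicz $m$-valued propositional logic with modus ponens (MP), plus A1: $(\phi\succ(\psi\wedge\theta))\rightarrow((\phi\succ\psi)\wedge(\phi\succ\theta))$; A2: $((\phi\succ\psi)\wedge(\phi\succ\theta))\rightarrow(\phi\succ(\psi\wedge\theta))$; A3: $\phi\succ\mathbf{t}$; rules (RCEA): from $\phi\leftrightarrow\psi$ infer $(\phi\succ\theta)\leftrightarrow(\psi\succ\theta)$; (RCEC): from $\phi\leftrightarrow\psi$ infer $(\theta\succ\phi)\leftrightarrow(\theta\succ\psi)$; $(\mathrm{R}_a)$, $a\in\mathcal{T}$: from $\rightarrow_{i=1}^{m}(\mathbf{I}_{a_i\odot b}(\gamma_i),\mathbf{I}_{a\odot b}(\gamma))$ for every $b\in\mathcal{T}$ infer $\rightarrow_{i=1}^{m}(\mathbf{I}_{a_i}(\phi\succ\gamma_i),\mathbf{I}_{a}(\phi\succ\gamma))$,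 where $a_i=\frac{m-i}{m-1}$. $\Gamma\vdash_{\mathbf{LCR}}\phi$ means there is a finite sequence ending with $\phi$ each member of which is a theorem of $\mathbf{LCR}$, a member of $\Gamma$, or obtained by MP from earlier members. A set $\Gamma$ is consistent if there is no $\phi$ with $\Gamma\vdash_{\mathbf{LCR}}\phi$ and $\Gamma\vdash_{\mathbf{LCR}}\neg\phi$; it is maximal consistent if it is consistent, $\phi\in\Gamma$ iff $\Gamma\vdash_{\mathbf{LCR}}\phi$, and no proper superset of $\Gamma$ is consistent. Canonical model: $W^c$ is the set of maximal consistent sets; for a formula $\phi$, $/\phi/=(/\phi/_1,\dots,/\phi/_m)$ with $/\phi/_i=\{\Gamma\in W^c:\mathbf{J}_{\frac{i-1}{m-1}}(\phi)\in\Gamma\}$; $\mathcal{A}^c=\{/\phi/:\phi \text{ a formula}\}$; for $x,y\in W^c$, $xR^c_{/\phi/}y=\bigwedge\{a\rightarrow b: \psi \text{ a formula},\ a,b\in\mathcal{T},\ \mathbf{J}_a(\phi\succ\psi)\in x,\ \mathbf{J}_b(\psi)\in y\}$; and $V_x(p)=a$ iff $\mathbf{J}_a(p)\in x$ for $p\in\Pi$. -}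

module Defs where

open import Level using (Level; 0ℓ; Lift) renaming (suc to lsuc)
open import Data.Nat as ℕ using (ℕ; zero; suc; _∸_; _+_; _⊓_; s≤s)
open import Data.Nat.Properties using (m⊓n≤n)
open import Data.Fin as Fin using (Fin; toℕ; fromℕ; fromℕ<; opposite)
open import Data.List using (List; []; _∷_; map; filter; foldl; allFin)
open import Data.Product using (Σ; _×_; _,_; proj₁; proj₂; ∃)
open import Relation.Nullary using (¬_)
open import Relation.Binary.PropositionalEquality using (_≡_; _≢_)

-- Truth values.  For m = suc n (so n = m-1), the element k : Fin (suc n)
-- stands for the truth value k/(m-1) = k/n of 𝓣.

module Values (n : ℕ) where

  𝓣 : Set
  𝓣 = Fin (suc n)

  top : 𝓣
  top = fromℕ n

  bot : 𝓣
  bot = Fin.zero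

  ∼_ : 𝓣 → 𝓣
  ∼ a = opposite a

  -- a → b = min{1, 1 - a + b}
  _⟶_ : 𝓣 → 𝓣 → 𝓣
  a ⟶ b = fromℕ< {(n ∸ toℕ a + toℕ b) ⊓ n} (s≤s (m⊓n≤n (n ∸ toℕ a + toℕ b) n))

  -- a ⊙ b = max{0, a + b - 1}  ( = ∼(a → ∼b) )
  _⊙_ : 𝓣 → 𝓣 → 𝓣
  a ⊙ b = ∼ (a ⟶ (∼ b))

  _≼_ : 𝓣 → 𝓣 → Set
  a ≼ b = a Fin.≤ b

  IsMeet : ∀ {ℓ} → (𝓣 → Set ℓ) → 𝓣 → Set ℓ
  IsMeet S a = (∀ c → S c → a ≼ c) × (∀ d → (∀ c → S c → d ≼ c) → d ≼ a)

data PFm : Set where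
  pvar : ℕ → PFm
  pneg : PFm → PFm
  pimp : PFm → PFm → PFm

module PureSemantics (n : ℕ) where
  open Values n

  evalP : (ℕ → 𝓣) → PFm → 𝓣
  evalP v (pvar p)   = v p
  evalP v (pneg φ)   = ∼ evalP v φ
  evalP v (pimp φ ψ) = evalP v φ ⟶ evalP v ψ

  Taut : PFm → Set
  Taut τ = ∀ (v : ℕ → 𝓣) → evalP v τ ≡ top

  IsJOperator : (𝓣 → PFm) → Set
  IsJOperator J = ∀ (v : ℕ → 𝓣) (a : 𝓣) →
    (v 0 ≡ a → evalP v (J a) ≡ top) × (v 0 ≢ a → evalP v (J a) ≡ bot)

infixr 6 _⇒_
infixr 7 _≻_

data Fm : Set where
  var : ℕ → Fm
  ¬'_ : Fm → Fm
  _⇒_ : Fm → Fm → Fm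
  _≻_ : Fm → Fm → Fm

substP : (ℕ → Fm) → PFm → Fm
substP σ (pvar p)   = σ p
substP σ (pneg φ)   = ¬' substP σ φ
substP σ (pimp φ ψ) = substP σ φ ⇒ substP σ ψ

𝐭 : Fm
𝐭 = var 0 ⇒ var 0

_∨'_ : Fm → Fm → Fm
φ ∨' ψ = (φ ⇒ ψ) ⇒ ψ

_∧'_ : Fm → Fm → Fm
φ ∧' ψ = ¬' ((¬' φ) ∨' (¬' ψ))

_⇔'_ : Fm → Fm → Fm
φ ⇔' ψ = (φ ⇒ ψ) ∧' (ψ ⇒ φ)

-- right-nested disjunction φ₁ ∨ (φ₂ ∨ (… ∨ φₖ)) of a nonempty list
-- (the empty case never arises below)
⋁ : List Fm → Fm
⋁ []           = ¬' 𝐭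
⋁ (φ ∷ [])     = φ
⋁ (φ ∷ ψ ∷ φs) = φ ∨' ⋁ (ψ ∷ φs)

-- iterated implication →_{i=1}^{k}(φ_i, ψ) for the list [φ₁,…,φ_k]:
-- φ_k → (φ_{k-1} → … (φ₁ → ψ))
iterImp : List Fm → Fm → Fm
iterImp φs ψ = foldl (λ acc φ → φ ⇒ acc) ψ φs

module LCR (n : ℕ) (J : Fin (suc n) → PFm) where
  open Values n public
  open PureSemantics n public

  𝐉 : 𝓣 → Fm → Fm
  𝐉 a φ = substP (λ _ → φ) (J a)

  𝐈 : 𝓣 → Fm → Fm
  𝐈 a φ = ⋁ (map (λ b → 𝐉 b φ) (filter (a Fin.≤?_) (allFin (suc n))))

  -- index i ∈ {1,…,m} is represented by j : Fin m with i = j + 1;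
  -- a_i = (m - i)/(m - 1) is then  opposite j
  aᵢ : Fin (suc n) → 𝓣
  aᵢ j = opposite j

  overIdx : (Fin (suc n) → Fm) → List Fm
  overIdx F = map F (allFin (suc n))

  data Thm : Fm → Set where
    ax    : (τ : PFm) → Taut τ → (σ : ℕ → Fm) → Thm (substP σ τ)
    mp    : ∀ {φ ψ} → Thm φ → Thm (φ ⇒ ψ) → Thm ψ
    A1    : ∀ φ ψ θ → Thm ((φ ≻ (ψ ∧' θ)) ⇒ ((φ ≻ ψ) ∧' (φ ≻ θ)))
    A2    : ∀ φ ψ θ → Thm (((φ ≻ ψ) ∧' (φ ≻ θ)) ⇒ (φ ≻ (ψ ∧' θ)))
    A3    : ∀ φ → Thm (φ ≻ 𝐭)
    RCEA  : ∀ {φ ψ} θ → Thm (φ ⇔' ψ) → Thm ((φ ≻ θ) ⇔' (ψ ≻ θ))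
    RCEC  : ∀ {φ ψ} θ → Thm (φ ⇔' ψ) → Thm ((θ ≻ φ) ⇔' (θ ≻ ψ))
    Rₐ    : (a : 𝓣) (φ : Fm) (γs : Fin (suc n) → Fm) (γ : Fm) →
            (∀ (b : 𝓣) → Thm (iterImp (overIdx (λ j → 𝐈 (aᵢ j ⊙ b) (γs j)))
                                      (𝐈 (a ⊙ b) γ))) →
            Thm (iterImp (overIdx (λ j → 𝐈 (aᵢ j) (φ ≻ γs j))) (𝐈 a (φ ≻ γ)))

  FmSet : Set₁
  FmSet = Fm → Set

  _⊆_ : FmSet → FmSet → Set
  Γ ⊆ Δ = ∀ φ → Γ φ → Δ φ

  data _⊢_ (Γ : FmSet) : Fm → Set where
    thm : ∀ {φ} → Thm φ → Γ ⊢ φ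
    hyp : ∀ {φ} → Γ φ → Γ ⊢ φ
    mp  : ∀ {φ ψ} → Γ ⊢ φ → Γ ⊢ (φ ⇒ ψ) → Γ ⊢ ψ

  Consistent : FmSet → Set
  Consistent Γ = ¬ (Σ Fm λ φ → (Γ ⊢ φ) × (Γ ⊢ (¬' φ)))

  MaxConsistent : FmSet → Set₁
  MaxConsistent Γ =
    Consistent Γ
    × (∀ φ → (Γ φ → Γ ⊢ φ) × (Γ ⊢ φ → Γ φ))
    × (∀ (Δ : FmSet) → Γ ⊆ Δ → ¬ (Δ ⊆ Γ) → ¬ Consistent Δ)

  Wᶜ : Set₁
  Wᶜ = Σ FmSet MaxConsistent

  _∈_ : Fm → Wᶜ → Set
  φ ∈ x = proj₁ x φ

  Rᶜ : Wᶜ → Fm → Wᶜ → 𝓣 → Set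
  Rᶜ x φ y r = IsMeet (λ c → Σ Fm λ ψ → Σ 𝓣 λ a → Σ 𝓣 λ b →
                 (𝐉 a (φ ≻ ψ) ∈ x) × (𝐉 b ψ ∈ y) × (c ≡ (a ⟶ b))) r

  V : Wᶜ → Fm → 𝓣 → Set₁
  V x (var p) a = Lift (lsuc 0ℓ) (𝐉 a (var p) ∈ x)
  V x (¬' φ)  a = Σ 𝓣 λ b → V x φ b × Lift (lsuc 0ℓ) (a ≡ ∼ b)
  V x (φ ⇒ ψ) a = Σ 𝓣 λ b → Σ 𝓣 λ c → V x φ b × V x ψ c × Lift (lsuc 0ℓ) (a ≡ (b ⟶ c))
  V x (φ ≻ ψ) a = IsMeet (λ c → Σ Wᶜ λ y → Σ 𝓣 λ r → Σ 𝓣 λ v →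
                    Rᶜ x φ y r × V y ψ v × Lift (lsuc 0ℓ) (c ≡ (r ⟶ v))) a

-- The canonical value of θ at a world x is the unique a with 𝐉_a(θ) ∈ x. Since every Łukasiewicz
-- tautology is an axiom, this value commutes with ¬ and →, and a formula belongs to x exactly when
-- its value is 1. The truth lemma thus reduces to the ≻ clause: the value c of φ ≻ ψ at x must be
-- the meet of the arrows xRᶜy → V_y(ψ). That c is a lower bound is built into the definition of Rᶜ.
-- If no world realises an arrow ≤ c, then, by compactness, finitely many conditionals φ ≻ χ in x
-- already refute every candidate world; conjoining them yields premises of the rule R_{c + 1/(m-1)},
-- whose conclusion forces the value of φ ≻ ψ above c. Excluded middle is used for Lindenbaum's
-- lemma, for primeness of maximal sets, and for meets in the finite chain 𝓣.
module Submission where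

open import Defs
open import Level using (0ℓ; Lift; lift; lower) renaming (suc to lsuc)
open import Axiom.ExcludedMiddle using (ExcludedMiddle)
open import Function using (_∘_)
open import Data.Nat using (ℕ; zero; suc; _+_; _∸_; _⊓_; _⊔_; _≤_; _<_; z≤n; s≤s; _≤′_; ≤′-reflexive; ≤′-step)
open import Data.Nat.Properties
  using ( ≤-refl; ≤-reflexive; ≤-trans; ≤-antisym; ≤-total; ≤-pred; ≤⇒≤′; ≤∧≢⇒<; ≰⇒>; <-irrefl; n≤1+n
        ; m≤n⇒m<n∨m≡n; +-comm; +-suc; +-identityʳ; +-mono-≤; +-monoˡ-≤; +-monoʳ-≤; +-cancelˡ-≤; +-cancelʳ-≤
        ; m∸n+n≡m; n∸n≡0; m∸n≤m; ∸-monoʳ-≤; ∸-+-assoc; m∸[m∸n]≡n; +-∸-comm; m+n≤o⇒m≤o∸n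
        ; m⊓n≤m; ⊓-glb; m≤n⇒m⊓n≡m; m≤m⊔n; m≤n⊔m; module ≤-Reasoning )
  renaming (_≟_ to _≟ℕ_)
open import Data.Nat.Tactic.RingSolver using (solve-∀)
open import Data.Fin using (Fin; toℕ; fromℕ<; opposite)
open import Data.Fin.Properties
  using (toℕ-injective; toℕ-fromℕ<; toℕ-fromℕ; toℕ≤pred[n]; opposite-prop; opposite-involutive; any?)
  renaming (≤-antisym to ≼-antisym; _≟_ to _≟ᵗ_; _≤?_ to _≼?_)
open import Data.Product using (Σ; _×_; _,_; proj₁; proj₂)
open import Data.Sum using (_⊎_; inj₁; inj₂; [_,_]′)
open import Data.Empty using (⊥; ⊥-elim)
open import Data.List using (List; []; _∷_; _++_; map; filter; concatMap; cartesianProductWith; allFin; replicate)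
open import Data.List.Relation.Unary.All as All using (All; []; _∷_)
import Data.List.Relation.Unary.All.Properties as AllP
open import Data.List.Relation.Unary.Any as Any using (Any; here; there)
import Data.List.Relation.Unary.Any.Properties as AnyP
open import Data.List.Membership.Propositional using (lose) renaming (_∈_ to _∈ₗ_)
open import Data.List.Membership.Propositional.Properties
  using (∈-++⁺ˡ; ∈-++⁺ʳ; ∈-map⁺; ∈-filter⁺; ∈-filter⁻; ∈-concatMap⁺; ∈-cartesianProductWith⁺; ∈-allFin)
open import Relation.Nullary using (¬_; Dec; yes; no)
open import Relation.Nullary.Decidable using (map′; _×-dec_)
open import Relation.Binary.Definitions using (DecidableEquality)
open import Relation.Binary.PropositionalEquality

module ŁukasiewiczChain (n : ℕ) where
  open Values n

  toℕ≤n : (a : 𝓣) → toℕ a ≤ n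
  toℕ≤n = toℕ≤pred[n]

  toℕ-top : toℕ top ≡ n
  toℕ-top = toℕ-fromℕ n

  toℕ-∼ : ∀ a → toℕ (∼ a) ≡ n ∸ toℕ a
  toℕ-∼ = opposite-prop

  toℕ-⟶ : ∀ a b → toℕ (a ⟶ b) ≡ (n ∸ toℕ a + toℕ b) ⊓ n
  toℕ-⟶ a b = toℕ-fromℕ< _

  toℕ∼x+toℕx≡n : ∀ a → toℕ (∼ a) + toℕ a ≡ n
  toℕ∼x+toℕx≡n a = trans (cong (_+ toℕ a) (toℕ-∼ a)) (m∸n+n≡m (toℕ≤n a))

  ≼⟶⇒+≤ : ∀ {x b c} → x ≼ (b ⟶ c) → toℕ x + toℕ b ≤ n + toℕ c
  ≼⟶⇒+≤ {x} {b} {c} x≼b⟶c = begin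
    toℕ x + toℕ b             ≤⟨ +-monoˡ-≤ (toℕ b) (≤-trans x≼b⟶c (≤-trans (≤-reflexive (toℕ-⟶ b c)) (m⊓n≤m _ n))) ⟩
    n ∸ toℕ b + toℕ c + toℕ b ≡⟨ +-comm-middle (n ∸ toℕ b) (toℕ c) (toℕ b) ⟩
    n ∸ toℕ b + toℕ b + toℕ c ≡⟨ cong (_+ toℕ c) (m∸n+n≡m (toℕ≤n b)) ⟩
    n + toℕ c                 ∎
    where
    open ≤-Reasoning
    +-comm-middle : ∀ p q r → p + q + r ≡ p + r + q
    +-comm-middle = solve-∀

  +≤⇒≤toℕ⟶ : ∀ {x} {b c : 𝓣} → x ≤ n → x + toℕ b ≤ n + toℕ c → x ≤ toℕ (b ⟶ c)
  +≤⇒≤toℕ⟶ {x} {b} {c} x≤n x+b≤n+c = subst (x ≤_) (sym (toℕ-⟶ b c))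
    (⊓-glb (≤-trans (m+n≤o⇒m≤o∸n x x+b≤n+c) (≤-reflexive (+-∸-comm (toℕ c) (toℕ≤n b)))) x≤n)

  +≤⇒≼⟶ : ∀ {x b c} → toℕ x + toℕ b ≤ n + toℕ c → x ≼ (b ⟶ c)
  +≤⇒≼⟶ {x} = +≤⇒≤toℕ⟶ (toℕ≤n x)

  x≼top : ∀ x → x ≼ top
  x≼top x = subst (toℕ x ≤_) (sym toℕ-top) (toℕ≤n x)

  n≤toℕ⇒≡top : ∀ {x} → n ≤ toℕ x → x ≡ top
  n≤toℕ⇒≡top {x} n≤x = toℕ-injective (trans (≤-antisym (toℕ≤n x) n≤x) (sym toℕ-top))

  top≼⇒≡top : ∀ {x} → top ≼ x → x ≡ top
  top≼⇒≡top {x} top≼x = n≤toℕ⇒≡top (subst (_≤ toℕ x) toℕ-top top≼x)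

  ≼⇒⟶≡top : ∀ {a b} → a ≼ b → a ⟶ b ≡ top
  ≼⇒⟶≡top {a} {b} a≼b = top≼⇒≡top (+≤⇒≼⟶ (subst (λ z → z + toℕ a ≤ n + toℕ b) (sym toℕ-top) (+-monoʳ-≤ n a≼b)))

  ⟶≡top⇒≼ : ∀ {a b} → a ⟶ b ≡ top → a ≼ b
  ⟶≡top⇒≼ {a} {b} a⟶b≡top = +-cancelˡ-≤ n _ _
    (subst (λ z → z + toℕ a ≤ n + toℕ b) toℕ-top (≼⟶⇒+≤ (subst (top ≼_) (sym a⟶b≡top) (x≼top top))))

  x⟶x≡top : ∀ x → x ⟶ x ≡ top
  x⟶x≡top x = ≼⇒⟶≡top (≤-refl {toℕ x})

  bot⟶x≡top : ∀ x → bot ⟶ x ≡ top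
  bot⟶x≡top x = ≼⇒⟶≡top z≤n

  x⟶top≡top : ∀ x → x ⟶ top ≡ top
  x⟶top≡top x = ≼⇒⟶≡top (x≼top x)

  top⟶x≡x : ∀ x → top ⟶ x ≡ x
  top⟶x≡x x = toℕ-injective (begin
    toℕ (top ⟶ x)                ≡⟨ toℕ-⟶ top x ⟩
    (n ∸ toℕ top + toℕ x) ⊓ n    ≡⟨ cong (λ z → (n ∸ z + toℕ x) ⊓ n) toℕ-top ⟩
    (n ∸ n + toℕ x) ⊓ n          ≡⟨ cong (λ z → (z + toℕ x) ⊓ n) (n∸n≡0 n) ⟩
    toℕ x ⊓ n                    ≡⟨ m≤n⇒m⊓n≡m (toℕ≤n x) ⟩
    toℕ x                        ∎)
    where open ≡-Reasoning

  x⟶bot≡∼x : ∀ x → x ⟶ bot ≡ ∼ x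
  x⟶bot≡∼x x = toℕ-injective (begin
    toℕ (x ⟶ bot)            ≡⟨ toℕ-⟶ x bot ⟩
    (n ∸ toℕ x + 0) ⊓ n      ≡⟨ cong (_⊓ n) (+-identityʳ _) ⟩
    (n ∸ toℕ x) ⊓ n          ≡⟨ m≤n⇒m⊓n≡m (m∸n≤m n (toℕ x)) ⟩
    n ∸ toℕ x                ≡⟨ toℕ-∼ x ⟨
    toℕ (∼ x)                ∎)
    where open ≡-Reasoning

  ∼-involutive : ∀ x → ∼ (∼ x) ≡ x
  ∼-involutive = opposite-involutive

  ∼top≡bot : ∼ top ≡ bot
  ∼top≡bot = toℕ-injective (trans (toℕ-∼ top) (trans (cong (n ∸_) toℕ-top) (n∸n≡0 n)))

  ∼bot≡top : ∼ bot ≡ top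
  ∼bot≡top = toℕ-injective (trans (toℕ-∼ bot) (sym toℕ-top))

  ∼-antitone : ∀ {a b} → a ≼ b → (∼ b) ≼ (∼ a)
  ∼-antitone {a} {b} a≼b = subst₂ _≤_ (sym (toℕ-∼ b)) (sym (toℕ-∼ a)) (∸-monoʳ-≤ n a≼b)

  x≼∼y⇒y≼∼x : ∀ {x y} → x ≼ (∼ y) → y ≼ (∼ x)
  x≼∼y⇒y≼∼x {x} {y} x≼∼y = subst (_≼ (∼ x)) (∼-involutive y) (∼-antitone x≼∼y)

  ∼x≼y⇒∼y≼x : ∀ {x y} → (∼ x) ≼ y → (∼ y) ≼ x
  ∼x≼y⇒∼y≼x {x} {y} ∼x≼y = subst ((∼ y) ≼_) (∼-involutive x) (∼-antitone ∼x≼y)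

  ⟶-antitoneˡ : ∀ {a b c} → a ≼ b → (b ⟶ c) ≼ (a ⟶ c)
  ⟶-antitoneˡ {a} {b} {c} a≼b =
    +≤⇒≼⟶ (≤-trans (+-monoʳ-≤ (toℕ (b ⟶ c)) a≼b) (≼⟶⇒+≤ {b ⟶ c} (≤-refl {toℕ (b ⟶ c)})))

  ⟶-modusPonens : ∀ a b → a ≼ ((a ⟶ b) ⟶ b)
  ⟶-modusPonens a b = +≤⇒≼⟶ (subst (_≤ n + toℕ b) (+-comm (toℕ (a ⟶ b)) (toℕ a))
    (≼⟶⇒+≤ {a ⟶ b} (≤-refl {toℕ (a ⟶ b)})))

  -- The value of φ ∧' ψ = ¬'((¬'φ ⇒ ¬'ψ) ⇒ ¬'ψ), i.e. the minimum.
  _∧ᵗ_ : 𝓣 → 𝓣 → 𝓣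
  p ∧ᵗ q = ∼ (((∼ p) ⟶ (∼ q)) ⟶ (∼ q))

  x∧ᵗy≼x : ∀ p q → (p ∧ᵗ q) ≼ p
  x∧ᵗy≼x p q = ∼x≼y⇒∼y≼x (⟶-modusPonens (∼ p) (∼ q))

  x∧ᵗy≼y : ∀ p q → (p ∧ᵗ q) ≼ q
  x∧ᵗy≼y p q = ∼x≼y⇒∼y≼x (+≤⇒≼⟶ (subst (_≤ n + toℕ (∼ q)) (+-comm (toℕ ((∼ p) ⟶ (∼ q))) (toℕ (∼ q)))
    (+-monoˡ-≤ (toℕ (∼ q)) (toℕ≤n ((∼ p) ⟶ (∼ q))))))

  ∧ᵗ-glb : ∀ {e p q} → e ≼ p → e ≼ q → e ≼ (p ∧ᵗ q)
  ∧ᵗ-glb {e} {p} {q} e≼p e≼q = x≼∼y⇒y≼∼x {Y} {e} Y≼∼e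
    where
    P = toℕ (∼ p)
    Q = toℕ (∼ q)
    X = (∼ p) ⟶ (∼ q)
    Y = X ⟶ (∼ q)
    Y≼∼e : Y ≼ (∼ e)
    Y≼∼e with ≤-total P Q
    ... | inj₁ P≤Q = subst (_≼ (∼ e)) (sym (trans (cong (_⟶ (∼ q)) (≼⇒⟶≡top P≤Q)) (top⟶x≡x (∼ q))))
                       (∼-antitone e≼q)
    ... | inj₂ Q≤P = ≤-trans toℕY≤P (∼-antitone e≼p)
      where
      toℕX : toℕ X ≡ n ∸ P + Q
      toℕX = trans (toℕ-⟶ (∼ p) (∼ q))
        (m≤n⇒m⊓n≡m (≤-trans (+-monoʳ-≤ (n ∸ P) Q≤P) (≤-reflexive (m∸n+n≡m (toℕ≤n (∼ p))))))
      toℕY≤P : toℕ Y ≤ P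
      toℕY≤P = begin
        toℕ Y                          ≡⟨ toℕ-⟶ X (∼ q) ⟩
        (n ∸ toℕ X + Q) ⊓ n            ≤⟨ m⊓n≤m _ n ⟩
        n ∸ toℕ X + Q                  ≡⟨ cong (λ z → n ∸ z + Q) toℕX ⟩
        n ∸ (n ∸ P + Q) + Q            ≡⟨ cong (_+ Q) (∸-+-assoc n (n ∸ P) Q) ⟨
        n ∸ (n ∸ P) ∸ Q + Q            ≡⟨ cong (λ z → z ∸ Q + Q) (m∸[m∸n]≡n (toℕ≤n (∼ p))) ⟩
        P ∸ Q + Q                      ≡⟨ m∸n+n≡m Q≤P ⟩
        P                              ∎
        where open ≤-Reasoning

  -- e ⊙ b ≤ f iff e + b ≤ 1 + f: unfold ⊙ = ∼(_ ⟶ ∼ _), residuate, and add f + b to both sides.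
  private
    ⊙-shiftˡ : ∀ (e b f : 𝓣) → toℕ (∼ f) + toℕ e + (toℕ f + toℕ b) ≡ n + (toℕ e + toℕ b)
    ⊙-shiftˡ e b f = trans (shuffle (toℕ (∼ f)) (toℕ e) (toℕ f) (toℕ b)) (cong (_+ (toℕ e + toℕ b)) (toℕ∼x+toℕx≡n f))
      where
      shuffle : ∀ p e f b → p + e + (f + b) ≡ (p + f) + (e + b)
      shuffle = solve-∀

    ⊙-shiftʳ : ∀ (b f : 𝓣) → n + toℕ (∼ b) + (toℕ f + toℕ b) ≡ n + (n + toℕ f)
    ⊙-shiftʳ b f = trans (shuffle n (toℕ (∼ b)) (toℕ f) (toℕ b)) (cong (λ z → n + (z + toℕ f)) (toℕ∼x+toℕx≡n b))
      where
      shuffle : ∀ n q f b → n + q + (f + b) ≡ n + ((q + b) + f)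
      shuffle = solve-∀

  ⊙≼⇒+≤ : ∀ {e b f} → (e ⊙ b) ≼ f → toℕ e + toℕ b ≤ n + toℕ f
  ⊙≼⇒+≤ {e} {b} {f} e⊙b≼f = +-cancelˡ-≤ n _ _ (subst₂ _≤_ (⊙-shiftˡ e b f) (⊙-shiftʳ b f)
    (+-monoˡ-≤ (toℕ f + toℕ b) (≼⟶⇒+≤ (∼x≼y⇒∼y≼x e⊙b≼f))))

  +≤⇒⊙≼ : ∀ {e b f} → toℕ e + toℕ b ≤ n + toℕ f → (e ⊙ b) ≼ f
  +≤⇒⊙≼ {e} {b} {f} e+b≤n+f = ∼x≼y⇒∼y≼x {f} {e ⟶ (∼ b)} (+≤⇒≼⟶ (+-cancelʳ-≤ (toℕ f + toℕ b) _ _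
    (subst₂ _≤_ (sym (⊙-shiftˡ e b f)) (sym (⊙-shiftʳ b f)) (+-monoʳ-≤ n e+b≤n+f))))

  +≤⇒⟶≼ : ∀ {b v c} → n + toℕ v ≤ toℕ c + toℕ b → (b ⟶ v) ≼ c
  +≤⇒⟶≼ {b} {v} {c} n+v≤c+b = subst (_≤ toℕ c) (sym (toℕ-⟶ b v)) (≤-trans (m⊓n≤m _ n)
    (+-cancelʳ-≤ (toℕ b) _ _ (subst (_≤ toℕ c + toℕ b) (sym n∸b+v+b≡n+v) n+v≤c+b)))
    where
    +-comm-middle : ∀ p q r → p + q + r ≡ p + r + q
    +-comm-middle = solve-∀
    n∸b+v+b≡n+v : n ∸ toℕ b + toℕ v + toℕ b ≡ n + toℕ v
    n∸b+v+b≡n+v = trans (+-comm-middle (n ∸ toℕ b) (toℕ v) (toℕ b)) (cong (_+ toℕ v) (m∸n+n≡m (toℕ≤n b)))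

  IsMeet-unique : ∀ {ℓ} {S : 𝓣 → Set ℓ} {a b} → IsMeet S a → IsMeet S b → a ≡ b
  IsMeet-unique ma mb = ≼-antisym (proj₂ mb _ (proj₁ ma)) (proj₂ ma _ (proj₁ mb))

  -- Lower bounds need not be decidable, so the greatest one is found by a classical downward search.
  meet-exists : ExcludedMiddle 0ℓ → (S : 𝓣 → Set) → Σ 𝓣 (IsMeet S)
  meet-exists em S =
    let d , d-lb , d-greatest = search n ≤-refl in d , d-lb , λ d' d'-lb → d-greatest d' (toℕ≤n d') d'-lb
    where
    LowerBound : 𝓣 → Set
    LowerBound d = ∀ c → S c → d ≼ c
    search : ∀ k → k ≤ n → Σ 𝓣 λ d → LowerBound d × (∀ d' → toℕ d' ≤ k → LowerBound d' → d' ≼ d)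
    search zero _ = bot , (λ _ _ → z≤n) , (λ _ d'≤0 _ → d'≤0)
    search (suc k) k<n with em {LowerBound (fromℕ< (s≤s k<n))}
    ... | yes lb = fromℕ< (s≤s k<n) , lb , λ d' d'≤k _ → subst (toℕ d' ≤_) (sym (toℕ-fromℕ< (s≤s k<n))) d'≤k
    ... | no ¬lb with search k (≤-trans (n≤1+n k) k<n)
    ...   | d , d-lb , d-greatest = d , d-lb , λ d' d'≤1+k d'-lb → [_,_]′
            (λ { (s≤s d'≤k) → d-greatest d' d'≤k d'-lb })
            (λ d'≡1+k → ⊥-elim (¬lb (subst LowerBound (toℕ-injective (trans d'≡1+k (sym (toℕ-fromℕ< (s≤s k<n))))) d'-lb)))
            (m≤n⇒m<n∨m≡n d'≤1+k)

⊥ᶠ : Fm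
⊥ᶠ = ¬' 𝐭

⋀ : List Fm → Fm
⋀ []       = 𝐭
⋀ (χ ∷ χs) = χ ∧' ⋀ χs

_≟ᶠ_ : DecidableEquality Fm
var p    ≟ᶠ var q    = map′ (cong var) (λ { refl → refl }) (p ≟ℕ q)
(¬' φ)   ≟ᶠ (¬' ψ)   = map′ (cong ¬'_) (λ { refl → refl }) (φ ≟ᶠ ψ)
(φ ⇒ φ') ≟ᶠ (ψ ⇒ ψ') = map′ (λ (e , e') → cong₂ _⇒_ e e') (λ { refl → refl , refl }) (φ ≟ᶠ ψ ×-dec φ' ≟ᶠ ψ')
(φ ≻ φ') ≟ᶠ (ψ ≻ ψ') = map′ (λ (e , e') → cong₂ _≻_ e e') (λ { refl → refl , refl }) (φ ≟ᶠ ψ ×-dec φ' ≟ᶠ ψ')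
var _    ≟ᶠ (¬' _)   = no λ ()
var _    ≟ᶠ (_ ⇒ _)  = no λ ()
var _    ≟ᶠ (_ ≻ _)  = no λ ()
(¬' _)   ≟ᶠ var _    = no λ ()
(¬' _)   ≟ᶠ (_ ⇒ _)  = no λ ()
(¬' _)   ≟ᶠ (_ ≻ _)  = no λ ()
(_ ⇒ _)  ≟ᶠ var _    = no λ ()
(_ ⇒ _)  ≟ᶠ (¬' _)   = no λ ()
(_ ⇒ _)  ≟ᶠ (_ ≻ _)  = no λ ()
(_ ≻ _)  ≟ᶠ var _    = no λ ()
(_ ≻ _)  ≟ᶠ (¬' _)   = no λ ()
(_ ≻ _)  ≟ᶠ (_ ⇒ _)  = no λ ()

atoms : Fm → List Fm
atoms (var p)  = var p ∷ []
atoms (¬' φ)   = atoms φ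
atoms (φ ⇒ ψ)  = atoms φ ++ atoms ψ
atoms (φ ≻ ψ)  = (φ ≻ ψ) ∷ []

position : List Fm → Fm → ℕ
position []       α = 0
position (β ∷ βs) α with β ≟ᶠ α
... | yes _ = 0
... | no  _ = suc (position βs α)

-- 𝐭 is a junk value for out-of-range indices.
nth : List Fm → ℕ → Fm
nth []       _       = 𝐭
nth (β ∷ βs) zero    = β
nth (β ∷ βs) (suc k) = nth βs k

nth-position : ∀ {α} βs → α ∈ₗ βs → nth βs (position βs α) ≡ α
nth-position {α} (β ∷ βs) α∈ with β ≟ᶠ α
... | yes β≡α = β≡α
nth-position {α} (β ∷ βs) (here α≡β)  | no β≢α = ⊥-elim (β≢α (sym α≡β))
nth-position {α} (β ∷ βs) (there α∈) | no _   = nth-position βs α∈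

skeleton : List Fm → Fm → PFm
skeleton βs (var p) = pvar (position βs (var p))
skeleton βs (¬' φ)  = pneg (skeleton βs φ)
skeleton βs (φ ⇒ ψ) = pimp (skeleton βs φ) (skeleton βs ψ)
skeleton βs (φ ≻ ψ) = pvar (position βs (φ ≻ ψ))

substP-skeleton : ∀ βs θ → (∀ {α} → α ∈ₗ atoms θ → α ∈ₗ βs) → substP (nth βs) (skeleton βs θ) ≡ θ
substP-skeleton βs (var p) atoms⊆ = nth-position βs (atoms⊆ (here refl))
substP-skeleton βs (¬' θ)  atoms⊆ = cong ¬'_ (substP-skeleton βs θ atoms⊆)
substP-skeleton βs (θ ⇒ ψ) atoms⊆ = cong₂ _⇒_ (substP-skeleton βs θ (atoms⊆ ∘ ∈-++⁺ˡ))
                                              (substP-skeleton βs ψ (atoms⊆ ∘ ∈-++⁺ʳ (atoms θ)))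
substP-skeleton βs (θ ≻ ψ) atoms⊆ = nth-position βs (atoms⊆ (here refl))

stage : ℕ → List Fm
stage zero    = []
stage (suc k) = stage k ++ (var k ∷ map ¬'_ (stage k) ++ cartesianProductWith _⇒_ (stage k) (stage k)
                                                     ++ cartesianProductWith _≻_ (stage k) (stage k))

stage-mono : ∀ {k k' φ} → k ≤ k' → φ ∈ₗ stage k → φ ∈ₗ stage k'
stage-mono k≤k' = go (≤⇒≤′ k≤k')
  where
  go : ∀ {k k' φ} → k ≤′ k' → φ ∈ₗ stage k → φ ∈ₗ stage k'
  go (≤′-reflexive refl) φ∈ = φ∈
  go (≤′-step k≤′k')     φ∈ = ∈-++⁺ˡ (go k≤′k' φ∈)

stage-complete : ∀ φ → Σ ℕ λ k → φ ∈ₗ stage k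
stage-complete (var p) = suc p , ∈-++⁺ʳ (stage p) (here refl)
stage-complete (¬' φ) with stage-complete φ
... | k , φ∈ = suc k , ∈-++⁺ʳ (stage k) (there (∈-++⁺ˡ (∈-map⁺ ¬'_ φ∈)))
stage-complete (φ ⇒ ψ) with stage-complete φ | stage-complete ψ
... | i , φ∈ | j , ψ∈ = suc (i ⊔ j) , ∈-++⁺ʳ (stage (i ⊔ j)) (there (∈-++⁺ʳ (map ¬'_ (stage (i ⊔ j)))
      (∈-++⁺ˡ (∈-cartesianProductWith⁺ _⇒_ (stage-mono (m≤m⊔n i j) φ∈) (stage-mono (m≤n⊔m i j) ψ∈)))))
stage-complete (φ ≻ ψ) with stage-complete φ | stage-complete ψ
... | i , φ∈ | j , ψ∈ = suc (i ⊔ j) , ∈-++⁺ʳ (stage (i ⊔ j)) (there (∈-++⁺ʳ (map ¬'_ (stage (i ⊔ j)))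
      (∈-++⁺ʳ (cartesianProductWith _⇒_ (stage (i ⊔ j)) (stage (i ⊔ j)))
        (∈-cartesianProductWith⁺ _≻_ (stage-mono (m≤m⊔n i j) φ∈) (stage-mono (m≤n⊔m i j) ψ∈)))))

module Valuations (n : ℕ) (1≤n : 1 ≤ n) (J : Fin (suc n) → PFm) (isJ : PureSemantics.IsJOperator n J) where
  open LCR n J
  open ŁukasiewiczChain n

  top≢bot : top ≢ bot
  top≢bot top≡bot with subst (1 ≤_) (trans (sym toℕ-top) (cong toℕ top≡bot)) 1≤n
  ... | ()

  record IsValuation (w : Fm → 𝓣) : Set where
    field
      ¬-homo : ∀ φ → w (¬' φ) ≡ ∼ (w φ)
      ⇒-homo : ∀ φ ψ → w (φ ⇒ ψ) ≡ (w φ ⟶ w ψ)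

  Valid : Fm → Set
  Valid θ = ∀ w → IsValuation w → w θ ≡ top

  Crisp : (Fm → 𝓣) → Fm → Set
  Crisp w β = w β ≡ top ⊎ w β ≡ bot

  AlwaysCrisp : Fm → Set
  AlwaysCrisp β = ∀ w → IsValuation w → Crisp w β

  module _ {w : Fm → 𝓣} (w-val : IsValuation w) where
    open IsValuation w-val

    value-substP : ∀ σ τ → w (substP σ τ) ≡ evalP (w ∘ σ) τ
    value-substP σ (pvar p)   = refl
    value-substP σ (pneg τ)   = trans (¬-homo _) (cong ∼_ (value-substP σ τ))
    value-substP σ (pimp τ υ) = trans (⇒-homo _ _) (cong₂ _⟶_ (value-substP σ τ) (value-substP σ υ))

    ≡⇒value-𝐉≡top : ∀ a θ → w θ ≡ a → w (𝐉 a θ) ≡ top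
    ≡⇒value-𝐉≡top a θ wθ≡a = trans (value-substP (λ _ → θ) (J a)) (proj₁ (isJ (λ _ → w θ) a) wθ≡a)

    ≢⇒value-𝐉≡bot : ∀ a θ → w θ ≢ a → w (𝐉 a θ) ≡ bot
    ≢⇒value-𝐉≡bot a θ wθ≢a = trans (value-substP (λ _ → θ) (J a)) (proj₂ (isJ (λ _ → w θ) a) wθ≢a)

    value-𝐉≡top⇒ : ∀ a θ → w (𝐉 a θ) ≡ top → w θ ≡ a
    value-𝐉≡top⇒ a θ w𝐉≡top with w θ ≟ᵗ a
    ... | yes wθ≡a = wθ≡a
    ... | no  wθ≢a = ⊥-elim (top≢bot (trans (sym w𝐉≡top) (≢⇒value-𝐉≡bot a θ wθ≢a)))

    𝐉-crisp : ∀ a θ → Crisp w (𝐉 a θ)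
    𝐉-crisp a θ with w θ ≟ᵗ a
    ... | yes wθ≡a = inj₁ (≡⇒value-𝐉≡top a θ wθ≡a)
    ... | no  wθ≢a = inj₂ (≢⇒value-𝐉≡bot a θ wθ≢a)

    ¬-crisp : ∀ β → Crisp w β → Crisp w (¬' β)
    ¬-crisp β (inj₁ wβ≡top) = inj₂ (trans (¬-homo β) (trans (cong ∼_ wβ≡top) ∼top≡bot))
    ¬-crisp β (inj₂ wβ≡bot) = inj₁ (trans (¬-homo β) (trans (cong ∼_ wβ≡bot) ∼bot≡top))

    value-𝐭 : w 𝐭 ≡ top
    value-𝐭 = trans (⇒-homo _ _) (x⟶x≡top (w (var 0)))

    value-⊥ᶠ : w ⊥ᶠ ≡ bot
    value-⊥ᶠ = trans (¬-homo _) (trans (cong ∼_ value-𝐭) ∼top≡bot)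

    value-∨-top : ∀ φ ψ → w φ ≡ top → w (φ ∨' ψ) ≡ top
    value-∨-top φ ψ wφ≡top = begin
      w ((φ ⇒ ψ) ⇒ ψ)        ≡⟨ trans (⇒-homo _ _) (cong (_⟶ w ψ) (⇒-homo φ ψ)) ⟩
      (w φ ⟶ w ψ) ⟶ w ψ      ≡⟨ cong (λ z → (z ⟶ w ψ) ⟶ w ψ) wφ≡top ⟩
      (top ⟶ w ψ) ⟶ w ψ      ≡⟨ cong (_⟶ w ψ) (top⟶x≡x (w ψ)) ⟩
      w ψ ⟶ w ψ              ≡⟨ x⟶x≡top (w ψ) ⟩
      top                    ∎
      where open ≡-Reasoning

    value-∨-bot : ∀ φ ψ → w φ ≡ bot → w (φ ∨' ψ) ≡ w ψ
    value-∨-bot φ ψ wφ≡bot = begin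
      w ((φ ⇒ ψ) ⇒ ψ)        ≡⟨ trans (⇒-homo _ _) (cong (_⟶ w ψ) (⇒-homo φ ψ)) ⟩
      (w φ ⟶ w ψ) ⟶ w ψ      ≡⟨ cong (λ z → (z ⟶ w ψ) ⟶ w ψ) wφ≡bot ⟩
      (bot ⟶ w ψ) ⟶ w ψ      ≡⟨ cong (_⟶ w ψ) (bot⟶x≡top (w ψ)) ⟩
      top ⟶ w ψ              ≡⟨ top⟶x≡x (w ψ) ⟩
      w ψ                    ∎
      where open ≡-Reasoning

    value-∧ : ∀ φ ψ → w (φ ∧' ψ) ≡ (w φ ∧ᵗ w ψ)
    value-∧ φ ψ = trans (¬-homo _) (cong ∼_ (trans (⇒-homo _ _)
      (cong₂ _⟶_ (trans (⇒-homo _ _) (cong₂ _⟶_ (¬-homo φ) (¬-homo ψ))) (¬-homo ψ))))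

    value-⋀≼ : ∀ {χ χs} → χ ∈ₗ χs → w (⋀ χs) ≼ w χ
    value-⋀≼ {χ} {χ ∷ χs} (here refl) = subst (_≼ w χ) (sym (value-∧ χ (⋀ χs))) (x∧ᵗy≼x (w χ) (w (⋀ χs)))
    value-⋀≼ {χ} {χ' ∷ χs} (there χ∈χs) =
      ≤-trans (subst (_≼ w (⋀ χs)) (sym (value-∧ χ' (⋀ χs))) (x∧ᵗy≼y (w χ') (w (⋀ χs)))) (value-⋀≼ χ∈χs)

    ⋁-crisp : ∀ βs → All (Crisp w) βs → Crisp w (⋁ βs)
    ⋁-crisp []           []                    = inj₂ value-⊥ᶠ
    ⋁-crisp (β ∷ [])     (c ∷ [])              = c
    ⋁-crisp (β ∷ γ ∷ βs) (inj₁ wβ≡top ∷ _)     = inj₁ (value-∨-top β _ wβ≡top)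
    ⋁-crisp (β ∷ γ ∷ βs) (inj₂ wβ≡bot ∷ cs) with ⋁-crisp (γ ∷ βs) cs
    ... | inj₁ e = inj₁ (trans (value-∨-bot β _ wβ≡bot) e)
    ... | inj₂ e = inj₂ (trans (value-∨-bot β _ wβ≡bot) e)

    ⋁≡top⇒Any : ∀ βs → All (Crisp w) βs → w (⋁ βs) ≡ top → Any (λ β → w β ≡ top) βs
    ⋁≡top⇒Any []           []                  w⋁≡top = ⊥-elim (top≢bot (trans (sym w⋁≡top) value-⊥ᶠ))
    ⋁≡top⇒Any (β ∷ [])     _                   w⋁≡top = here w⋁≡top
    ⋁≡top⇒Any (β ∷ γ ∷ βs) (inj₁ wβ≡top ∷ _)   _      = here wβ≡top
    ⋁≡top⇒Any (β ∷ γ ∷ βs) (inj₂ wβ≡bot ∷ cs)  w⋁≡top =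
      there (⋁≡top⇒Any (γ ∷ βs) cs (trans (sym (value-∨-bot β _ wβ≡bot)) w⋁≡top))

    Any⇒⋁≡top : ∀ βs → All (Crisp w) βs → Any (λ β → w β ≡ top) βs → w (⋁ βs) ≡ top
    Any⇒⋁≡top (β ∷ [])     _                  (here wβ≡top) = wβ≡top
    Any⇒⋁≡top (β ∷ γ ∷ βs) _                  (here wβ≡top) = value-∨-top β _ wβ≡top
    Any⇒⋁≡top (β ∷ γ ∷ βs) (inj₁ wβ≡top ∷ _)  (there _)     = value-∨-top β _ wβ≡top
    Any⇒⋁≡top (β ∷ γ ∷ βs) (inj₂ wβ≡bot ∷ cs) (there any)   =
      trans (value-∨-bot β _ wβ≡bot) (Any⇒⋁≡top (γ ∷ βs) cs any)

    private
      above : 𝓣 → List 𝓣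
      above a = filter (a ≼?_) (allFin (suc n))

      𝐉s-crisp : ∀ θ bs → All (Crisp w) (map (λ b → 𝐉 b θ) bs)
      𝐉s-crisp θ bs = AllP.map⁺ (All.universal (λ b → 𝐉-crisp b θ) bs)

    𝐈-crisp : ∀ a θ → Crisp w (𝐈 a θ)
    𝐈-crisp a θ = ⋁-crisp _ (𝐉s-crisp θ (above a))

    value-𝐈≡top⇒ : ∀ a θ → w (𝐈 a θ) ≡ top → a ≼ w θ
    value-𝐈≡top⇒ a θ w𝐈≡top = proj₂ (∈-filter⁻ (a ≼?_) {xs = allFin (suc n)}
      (Any.map (value-𝐉≡top⇒ _ θ) (AnyP.map⁻ (⋁≡top⇒Any _ (𝐉s-crisp θ (above a)) w𝐈≡top))))

    ≼⇒value-𝐈≡top : ∀ a θ → a ≼ w θ → w (𝐈 a θ) ≡ top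
    ≼⇒value-𝐈≡top a θ a≼wθ = Any⇒⋁≡top _ (𝐉s-crisp θ (above a))
      (AnyP.map⁺ (Any.map (≡⇒value-𝐉≡top _ θ) (∈-filter⁺ (a ≼?_) (∈-allFin (w θ)) a≼wθ)))

    iterImp-intro : ∀ hs c → All (Crisp w) hs → (All (λ h → w h ≡ top) hs → w c ≡ top) → w (iterImp hs c) ≡ top
    iterImp-intro []       c []       k = k []
    iterImp-intro (h ∷ hs) c (ch ∷ cs) k = iterImp-intro hs (h ⇒ c) cs (λ hs≡top → ⇒-intro ch hs≡top)
      where
      ⇒-intro : Crisp w h → All (λ h → w h ≡ top) hs → w (h ⇒ c) ≡ top
      ⇒-intro (inj₁ wh≡top) hs≡top = trans (⇒-homo h c) (trans (cong (w h ⟶_) (k (wh≡top ∷ hs≡top))) (x⟶top≡top (w h)))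
      ⇒-intro (inj₂ wh≡bot) _      = trans (⇒-homo h c) (trans (cong (_⟶ w c) wh≡bot) (bot⟶x≡top (w c)))

    iterImp-elim : ∀ hs c → w (iterImp hs c) ≡ top → All (λ h → w h ≡ top) hs → w c ≡ top
    iterImp-elim []       c w≡top []                = w≡top
    iterImp-elim (h ∷ hs) c w≡top (wh≡top ∷ hs≡top) = top≼⇒≡top (subst (_≼ w c) wh≡top
      (⟶≡top⇒≼ (trans (sym (⇒-homo h c)) (iterImp-elim hs (h ⇒ c) w≡top hs≡top))))

    iterImp-top : ∀ hs c → w c ≡ top → w (iterImp hs c) ≡ top
    iterImp-top []       c wc≡top = wc≡top
    iterImp-top (h ∷ hs) c wc≡top =
      iterImp-top hs (h ⇒ c) (trans (⇒-homo h c) (trans (cong (w h ⟶_) wc≡top) (x⟶top≡top (w h))))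

  iterImp-replicate-suc : ∀ θ k ψ → iterImp (replicate (suc k) θ) ψ ≡ θ ⇒ iterImp (replicate k θ) ψ
  iterImp-replicate-suc θ zero    ψ = refl
  iterImp-replicate-suc θ (suc k) ψ = iterImp-replicate-suc θ k (θ ⇒ ψ)

  -- Each premise θ of value below 1 adds at least 1/n to the value of θ → ⋯ → θ → ψ.
  ≤-value-iterImp-replicate : ∀ {w} → IsValuation w → ∀ θ → toℕ (w θ) < n →
                               ∀ k ψ → k ≤ n → k ≤ toℕ (w (iterImp (replicate k θ) ψ))
  ≤-value-iterImp-replicate w-val θ wθ<n zero    ψ _   = z≤n
  ≤-value-iterImp-replicate {w} w-val θ wθ<n (suc k) ψ 1+k≤n =
    subst (λ z → suc k ≤ toℕ z) (sym (trans (cong w (iterImp-replicate-suc θ k ψ)) (IsValuation.⇒-homo w-val θ _)))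
      (+≤⇒≤toℕ⟶ 1+k≤n (subst (_≤ n + toℕ v) (trans (sym (+-suc (toℕ (w θ)) k)) (+-comm (toℕ (w θ)) (suc k)))
        (+-mono-≤ wθ<n (≤-value-iterImp-replicate w-val θ wθ<n k ψ (≤-trans (n≤1+n k) 1+k≤n)))))
    where
    v = w (iterImp (replicate k θ) ψ)

  extend : (Fm → 𝓣) → Fm → 𝓣
  extend f (var p) = f (var p)
  extend f (¬' φ)  = ∼ extend f φ
  extend f (φ ⇒ ψ) = extend f φ ⟶ extend f ψ
  extend f (φ ≻ ψ) = f (φ ≻ ψ)

  extend-valuation : ∀ f → IsValuation (extend f)
  extend-valuation f = record { ¬-homo = λ _ → refl ; ⇒-homo = λ _ _ → refl }

  evalP-skeleton : ∀ βs v θ → evalP v (skeleton βs θ) ≡ extend (v ∘ position βs) θ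
  evalP-skeleton βs v (var p) = refl
  evalP-skeleton βs v (¬' θ)  = cong ∼_ (evalP-skeleton βs v θ)
  evalP-skeleton βs v (θ ⇒ ψ) = cong₂ _⟶_ (evalP-skeleton βs v θ) (evalP-skeleton βs v ψ)
  evalP-skeleton βs v (θ ≻ ψ) = refl

  -- A valid formula is a substitution instance of its skeleton, which is a tautology.
  Valid⇒Thm : ∀ {θ} → Valid θ → Thm θ
  Valid⇒Thm {θ} valid = subst Thm (substP-skeleton (atoms θ) θ (λ α∈ → α∈))
    (ax (skeleton (atoms θ) θ)
        (λ v → trans (evalP-skeleton (atoms θ) v θ) (valid _ (extend-valuation (v ∘ position (atoms θ)))))
        (nth (atoms θ)))

module Derivations (n : ℕ) (1≤n : 1 ≤ n) (J : Fin (suc n) → PFm) (isJ : PureSemantics.IsJOperator n J) where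
  open LCR n J
  open ŁukasiewiczChain n
  open Valuations n 1≤n J isJ
  open IsValuation

  ∅ : FmSet
  ∅ _ = ⊥

  _,,_ : FmSet → Fm → FmSet
  (Γ ,, β) ψ = Γ ψ ⊎ ψ ≡ β

  ∅⊢⇒Thm : ∀ {φ} → ∅ ⊢ φ → Thm φ
  ∅⊢⇒Thm (thm t)   = t
  ∅⊢⇒Thm (mp d d') = mp (∅⊢⇒Thm d) (∅⊢⇒Thm d')

  ⊢-cut : ∀ {Γ Δ φ} → (∀ ψ → Γ ψ → Δ ⊢ ψ) → Γ ⊢ φ → Δ ⊢ φ
  ⊢-cut Δ⊢Γ (thm t)   = thm t
  ⊢-cut Δ⊢Γ (hyp γ)   = Δ⊢Γ _ γ
  ⊢-cut Δ⊢Γ (mp d d') = mp (⊢-cut Δ⊢Γ d) (⊢-cut Δ⊢Γ d')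

  ⊢-mono : ∀ {Γ Δ φ} → Γ ⊆ Δ → Γ ⊢ φ → Δ ⊢ φ
  ⊢-mono Γ⊆Δ = ⊢-cut (λ ψ γ → hyp (Γ⊆Δ ψ γ))

  ⊢-compact : ∀ {Γ φ} → Γ ⊢ φ → Σ (List Fm) λ L → All Γ L × ((_∈ₗ L) ⊢ φ)
  ⊢-compact (thm t)       = [] , [] , thm t
  ⊢-compact (hyp {φ} γ)   = φ ∷ [] , γ ∷ [] , hyp (here refl)
  ⊢-compact (mp d d') with ⊢-compact d | ⊢-compact d'
  ... | L , L⊆Γ , e | L' , L'⊆Γ , e' =
    L ++ L' , AllP.++⁺ L⊆Γ L'⊆Γ , mp (⊢-mono (λ _ → ∈-++⁺ˡ) e) (⊢-mono (λ _ → ∈-++⁺ʳ L) e')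

  valid-⊢ : ∀ {Γ θ} → Valid θ → Γ ⊢ θ
  valid-⊢ valid = thm (Valid⇒Thm valid)

  valid-mp : ∀ {Γ φ ψ} → Valid (φ ⇒ ψ) → Γ ⊢ φ → Γ ⊢ ψ
  valid-mp valid d = mp d (valid-⊢ valid)

  valid-mp₂ : ∀ {Γ φ ψ χ} → Valid (φ ⇒ (ψ ⇒ χ)) → Γ ⊢ φ → Γ ⊢ ψ → Γ ⊢ χ
  valid-mp₂ valid d e = mp e (mp d (valid-⊢ valid))

  valid-I : ∀ φ → Valid (φ ⇒ φ)
  valid-I φ w w-val = trans (⇒-homo w-val _ _) (x⟶x≡top (w φ))

  valid-K : ∀ φ β → Valid (φ ⇒ (β ⇒ φ))
  valid-K φ β w w-val = trans (⇒-homo w-val _ _) (trans (cong (w φ ⟶_) (⇒-homo w-val β φ))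
    (≼⇒⟶≡top (+≤⇒≼⟶ {w φ} {w β} {w φ} (subst (_≤ n + toℕ (w φ)) (+-comm (toℕ (w β)) (toℕ (w φ)))
      (+-monoˡ-≤ (toℕ (w φ)) (toℕ≤n (w β)))))))

  -- Łukasiewicz logic lacks contraction, so S only holds when the shared antecedent is crisp.
  valid-S-crisp : ∀ β φ ψ → AlwaysCrisp β → Valid ((β ⇒ φ) ⇒ ((β ⇒ (φ ⇒ ψ)) ⇒ (β ⇒ ψ)))
  valid-S-crisp β φ ψ crisp w w-val = trans unfold (S-crisp (crisp w w-val))
    where
    open ≡-Reasoning
    a = w φ
    b = w ψ
    S : 𝓣 → 𝓣
    S z = (z ⟶ a) ⟶ ((z ⟶ (a ⟶ b)) ⟶ (z ⟶ b))
    unfold : w ((β ⇒ φ) ⇒ ((β ⇒ (φ ⇒ ψ)) ⇒ (β ⇒ ψ))) ≡ S (w β)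
    unfold = trans (⇒-homo w-val _ _) (cong₂ _⟶_ (⇒-homo w-val _ _) (trans (⇒-homo w-val _ _)
      (cong₂ _⟶_ (trans (⇒-homo w-val _ _) (cong (w β ⟶_) (⇒-homo w-val _ _))) (⇒-homo w-val _ _))))
    S-crisp : Crisp w β → S (w β) ≡ top
    S-crisp (inj₁ wβ≡top) = begin
      S (w β)                                       ≡⟨ cong S wβ≡top ⟩
      (top ⟶ a) ⟶ ((top ⟶ (a ⟶ b)) ⟶ (top ⟶ b))   ≡⟨ cong₂ _⟶_ (top⟶x≡x a) (cong₂ _⟶_ (top⟶x≡x (a ⟶ b)) (top⟶x≡x b)) ⟩
      a ⟶ ((a ⟶ b) ⟶ b)                             ≡⟨ ≼⇒⟶≡top (⟶-modusPonens a b) ⟩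
      top                                           ∎
    S-crisp (inj₂ wβ≡bot) = begin
      S (w β)                                       ≡⟨ cong S wβ≡bot ⟩
      (bot ⟶ a) ⟶ ((bot ⟶ (a ⟶ b)) ⟶ (bot ⟶ b))   ≡⟨ cong (λ z → (bot ⟶ a) ⟶ ((bot ⟶ (a ⟶ b)) ⟶ z)) (bot⟶x≡top b) ⟩
      (bot ⟶ a) ⟶ ((bot ⟶ (a ⟶ b)) ⟶ top)         ≡⟨ cong ((bot ⟶ a) ⟶_) (x⟶top≡top (bot ⟶ (a ⟶ b))) ⟩
      (bot ⟶ a) ⟶ top                               ≡⟨ x⟶top≡top (bot ⟶ a) ⟩
      top                                           ∎

  valid-¬-intro : ∀ β → Valid ((β ⇒ ⊥ᶠ) ⇒ ¬' β)
  valid-¬-intro β w w-val = trans (⇒-homo w-val _ _) (trans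
    (cong₂ _⟶_ (trans (⇒-homo w-val _ _) (trans (cong (w β ⟶_) (value-⊥ᶠ w-val)) (x⟶bot≡∼x (w β)))) (¬-homo w-val β))
    (x⟶x≡top (∼ (w β))))

  valid-¬-elim : ∀ φ → Valid (φ ⇒ (¬' φ ⇒ ⊥ᶠ))
  valid-¬-elim φ w w-val = trans (⇒-homo w-val _ _) (trans (cong (w φ ⟶_) (trans (⇒-homo w-val _ _)
    (trans (cong₂ _⟶_ (¬-homo w-val φ) (value-⊥ᶠ w-val)) (trans (x⟶bot≡∼x (∼ (w φ))) (∼-involutive (w φ))))))
    (x⟶x≡top (w φ)))

  deduction-crisp : ∀ {Γ β φ} → AlwaysCrisp β → (Γ ,, β) ⊢ φ → Γ ⊢ (β ⇒ φ)
  deduction-crisp {β = β} _     (thm {φ} t)          = valid-mp (valid-K φ β) (thm t)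
  deduction-crisp {β = β} _     (hyp {φ} (inj₁ γ))   = valid-mp (valid-K φ β) (hyp γ)
  deduction-crisp {β = β} _     (hyp (inj₂ refl))    = valid-⊢ (valid-I β)
  deduction-crisp {β = β} crisp (mp {φ} {ψ} d d')    =
    valid-mp₂ (valid-S-crisp β φ ψ crisp) (deduction-crisp crisp d) (deduction-crisp crisp d')

  Consistent⇒⊬⊥ᶠ : ∀ {Γ} → Consistent Γ → ¬ (Γ ⊢ ⊥ᶠ)
  Consistent⇒⊬⊥ᶠ consistent Γ⊢⊥ = consistent (𝐭 , valid-⊢ (λ _ w-val → value-𝐭 w-val) , Γ⊢⊥)

  ⊬⊥ᶠ⇒Consistent : ∀ {Γ} → ¬ (Γ ⊢ ⊥ᶠ) → Consistent Γ
  ⊬⊥ᶠ⇒Consistent Γ⊬⊥ (φ , Γ⊢φ , Γ⊢¬φ) = Γ⊬⊥ (valid-mp₂ (valid-¬-elim φ) Γ⊢φ Γ⊢¬φ)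

  Consistent-antimono : ∀ {Γ Δ} → Γ ⊆ Δ → Consistent Δ → Consistent Γ
  Consistent-antimono Γ⊆Δ consistent = ⊬⊥ᶠ⇒Consistent (Consistent⇒⊬⊥ᶠ consistent ∘ ⊢-mono Γ⊆Δ)

module CanonicalModel (n : ℕ) (1≤n : 1 ≤ n) (J : Fin (suc n) → PFm) (isJ : PureSemantics.IsJOperator n J)
                      (em : ExcludedMiddle 0ℓ) where
  open LCR n J
  open ŁukasiewiczChain n
  open Valuations n 1≤n J isJ
  open IsValuation
  open Derivations n 1≤n J isJ

  ¬Consistent⇒⊢⊥ᶠ : ∀ {Γ} → ¬ Consistent Γ → Γ ⊢ ⊥ᶠ
  ¬Consistent⇒⊢⊥ᶠ {Γ} inconsistent with em {Γ ⊢ ⊥ᶠ}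
  ... | yes Γ⊢⊥ = Γ⊢⊥
  ... | no  Γ⊬⊥ = ⊥-elim (inconsistent (⊬⊥ᶠ⇒Consistent Γ⊬⊥))

  module World (x : Wᶜ) where
    private
      Γ : FmSet
      Γ = proj₁ x

    consistent : Consistent Γ
    consistent = proj₁ (proj₂ x)

    ⊢⇒∈ : ∀ {φ} → Γ ⊢ φ → φ ∈ x
    ⊢⇒∈ = proj₂ (proj₁ (proj₂ (proj₂ x)) _)

    maximal : ∀ (Δ : FmSet) → Γ ⊆ Δ → ¬ (Δ ⊆ Γ) → ¬ Consistent Δ
    maximal = proj₂ (proj₂ (proj₂ x))

    ⊬⊥ᶠ : ¬ (Γ ⊢ ⊥ᶠ)
    ⊬⊥ᶠ = Consistent⇒⊬⊥ᶠ consistent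

    Thm⇒∈ : ∀ {φ} → Thm φ → φ ∈ x
    Thm⇒∈ t = ⊢⇒∈ (thm t)

    valid-closure : ∀ hs c → All (_∈ x) hs → Valid (iterImp hs c) → c ∈ x
    valid-closure hs c hs∈x valid = ⊢⇒∈ (iterMp hs c hs∈x (valid-⊢ valid))
      where
      iterMp : ∀ hs c → All (_∈ x) hs → Γ ⊢ iterImp hs c → Γ ⊢ c
      iterMp []       c []          d = d
      iterMp (h ∷ hs) c (h∈x ∷ hs∈x) d = mp (hyp h∈x) (iterMp hs (h ⇒ c) hs∈x d)

    ¬Valid-iterImp-⊥ᶠ : ∀ hs → All (_∈ x) hs → ¬ Valid (iterImp hs ⊥ᶠ)
    ¬Valid-iterImp-⊥ᶠ hs hs∈x valid = ⊬⊥ᶠ (hyp (valid-closure hs ⊥ᶠ hs∈x valid))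

    crisp-∈⊎¬∈ : ∀ {β} → AlwaysCrisp β → β ∈ x ⊎ (¬' β) ∈ x
    crisp-∈⊎¬∈ {β} crisp with em {β ∈ x}
    ... | yes β∈x = inj₁ β∈x
    ... | no  β∉x = inj₂ (⊢⇒∈ (valid-mp (valid-¬-intro β) (deduction-crisp crisp Γ,β⊢⊥)))
      where
      Γ,β⊢⊥ : (Γ ,, β) ⊢ ⊥ᶠ
      Γ,β⊢⊥ = ¬Consistent⇒⊢⊥ᶠ (maximal (Γ ,, β) (λ _ → inj₁) (λ Γ,β⊆Γ → β∉x (Γ,β⊆Γ β (inj₂ refl))))

    𝐉-unique : ∀ {u v θ} → 𝐉 u θ ∈ x → 𝐉 v θ ∈ x → u ≡ v
    𝐉-unique {u} {v} {θ} 𝐉uθ∈x 𝐉vθ∈x with u ≟ᵗ v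
    ... | yes u≡v = u≡v
    ... | no  u≢v = ⊥-elim (¬Valid-iterImp-⊥ᶠ (𝐉 u θ ∷ 𝐉 v θ ∷ []) (𝐉uθ∈x ∷ 𝐉vθ∈x ∷ []) λ w w-val →
          iterImp-intro w-val _ ⊥ᶠ (𝐉-crisp w-val u θ ∷ 𝐉-crisp w-val v θ ∷ [])
            λ { (w𝐉u≡top ∷ w𝐉v≡top ∷ []) →
                ⊥-elim (u≢v (trans (sym (value-𝐉≡top⇒ w-val u θ w𝐉u≡top)) (value-𝐉≡top⇒ w-val v θ w𝐉v≡top))) })

    𝐉-exists : ∀ θ → Σ 𝓣 λ u → 𝐉 u θ ∈ x
    𝐉-exists θ with any? (λ u → em {𝐉 u θ ∈ x})
    ... | yes found = found
    ... | no  none  = ⊥-elim (¬Valid-iterImp-⊥ᶠ (map ¬𝐉 (allFin (suc n))) (AllP.map⁺ (All.universal ¬𝐉∈x _)) valid)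
      where
      ¬𝐉 : 𝓣 → Fm
      ¬𝐉 u = ¬' 𝐉 u θ
      ¬𝐉∈x : ∀ u → ¬𝐉 u ∈ x
      ¬𝐉∈x u with crisp-∈⊎¬∈ (λ w w-val → 𝐉-crisp w-val u θ)
      ... | inj₁ 𝐉uθ∈x  = ⊥-elim (none (u , 𝐉uθ∈x))
      ... | inj₂ ¬𝐉uθ∈x = ¬𝐉uθ∈x
      valid : Valid (iterImp (map ¬𝐉 (allFin (suc n))) ⊥ᶠ)
      valid w w-val = iterImp-intro w-val _ ⊥ᶠ
        (AllP.map⁺ (All.universal (λ u → ¬-crisp w-val _ (𝐉-crisp w-val u θ)) _))
        λ all≡top → ⊥-elim (top≢bot (begin
          top                   ≡⟨ All.lookup (AllP.map⁻ all≡top) (∈-allFin (w θ)) ⟨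
          w (¬𝐉 (w θ))          ≡⟨ ¬-homo w-val _ ⟩
          ∼ w (𝐉 (w θ) θ)       ≡⟨ cong ∼_ (≡⇒value-𝐉≡top w-val (w θ) θ refl) ⟩
          ∼ top                 ≡⟨ ∼top≡bot ⟩
          bot                   ∎))
        where open ≡-Reasoning

    -- Abstract, so that type checking never unfolds the classical choice behind value.
    abstract
      value : Fm → 𝓣
      value θ = proj₁ (𝐉-exists θ)

      𝐉-value-∈ : ∀ θ → 𝐉 (value θ) θ ∈ x
      𝐉-value-∈ θ = proj₂ (𝐉-exists θ)

    𝐉∈⇒value≡ : ∀ {u θ} → 𝐉 u θ ∈ x → value θ ≡ u
    𝐉∈⇒value≡ = 𝐉-unique (𝐉-value-∈ _)

    value≡⇒𝐉∈ : ∀ {u θ} → value θ ≡ u → 𝐉 u θ ∈ x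
    value≡⇒𝐉∈ refl = 𝐉-value-∈ _

    value-¬ : ∀ θ → value (¬' θ) ≡ ∼ value θ
    value-¬ θ = 𝐉∈⇒value≡ (valid-closure (𝐉 (value θ) θ ∷ []) _ (𝐉-value-∈ θ ∷ []) λ w w-val →
      iterImp-intro w-val _ _ (𝐉-crisp w-val _ θ ∷ [])
        λ { (w𝐉≡top ∷ []) → ≡⇒value-𝐉≡top w-val _ (¬' θ)
              (trans (¬-homo w-val θ) (cong ∼_ (value-𝐉≡top⇒ w-val _ θ w𝐉≡top))) })

    value-⇒ : ∀ θ ψ → value (θ ⇒ ψ) ≡ (value θ ⟶ value ψ)
    value-⇒ θ ψ = 𝐉∈⇒value≡ (valid-closure (𝐉 (value θ) θ ∷ 𝐉 (value ψ) ψ ∷ []) _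
      (𝐉-value-∈ θ ∷ 𝐉-value-∈ ψ ∷ []) λ w w-val →
      iterImp-intro w-val _ _ (𝐉-crisp w-val _ θ ∷ 𝐉-crisp w-val _ ψ ∷ [])
        λ { (w𝐉θ≡top ∷ w𝐉ψ≡top ∷ []) → ≡⇒value-𝐉≡top w-val _ (θ ⇒ ψ)
              (trans (⇒-homo w-val θ ψ) (cong₂ _⟶_ (value-𝐉≡top⇒ w-val _ θ w𝐉θ≡top) (value-𝐉≡top⇒ w-val _ ψ w𝐉ψ≡top))) })

    value-valuation : IsValuation value
    value-valuation = record { ¬-homo = value-¬ ; ⇒-homo = value-⇒ }

    value≡top⇒∈ : ∀ {θ} → value θ ≡ top → θ ∈ x
    value≡top⇒∈ {θ} value≡top = valid-closure (𝐉 top θ ∷ []) θ (value≡⇒𝐉∈ value≡top ∷ []) λ w w-val →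
      iterImp-intro w-val _ θ (𝐉-crisp w-val top θ ∷ []) λ { (w𝐉≡top ∷ []) → value-𝐉≡top⇒ w-val top θ w𝐉≡top }

    -- If value θ = u < 1, then 𝐉_u(θ) → θ → ⋯ → θ → ⊥ (n copies of θ) is valid.
    ∈⇒value≡top : ∀ {θ} → θ ∈ x → value θ ≡ top
    ∈⇒value≡top {θ} θ∈x with value θ ≟ᵗ top
    ... | yes value≡top = value≡top
    ... | no  value≢top = ⊥-elim (¬Valid-iterImp-⊥ᶠ (𝐉 u θ ∷ replicate n θ) (𝐉-value-∈ θ ∷ AllP.replicate⁺ n θ∈x) valid)
      where
      u = value θ
      valid : Valid (iterImp (𝐉 u θ ∷ replicate n θ) ⊥ᶠ)
      valid w w-val with w θ ≟ᵗ u
      ... | yes wθ≡u = n≤toℕ⇒≡top (≤-value-iterImp-replicate w-val θ wθ<n n _ ≤-refl)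
        where
        wθ<n : toℕ (w θ) < n
        wθ<n = subst (λ z → toℕ z < n) (sym wθ≡u)
                 (≤∧≢⇒< (toℕ≤n u) (λ u≡n → value≢top (toℕ-injective (trans u≡n (sym toℕ-top)))))
      ... | no  wθ≢u = iterImp-top w-val (replicate n θ) (𝐉 u θ ⇒ ⊥ᶠ)
        (trans (⇒-homo w-val _ _) (trans (cong (_⟶ w ⊥ᶠ) (≢⇒value-𝐉≡bot w-val u θ wθ≢u)) (bot⟶x≡top _)))

    Thm⇒value≡top : ∀ {θ} → Thm θ → value θ ≡ top
    Thm⇒value≡top = ∈⇒value≡top ∘ Thm⇒∈

    ¬𝐈∈⇒⋠ : ∀ {a θ} → (¬' 𝐈 a θ) ∈ x → ¬ (a ≼ value θ)
    ¬𝐈∈⇒⋠ {a} {θ} ¬𝐈∈x a≼value = top≢bot (begin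
      top                  ≡⟨ ∈⇒value≡top ¬𝐈∈x ⟨
      value (¬' 𝐈 a θ)     ≡⟨ value-¬ (𝐈 a θ) ⟩
      ∼ value (𝐈 a θ)      ≡⟨ cong ∼_ (≼⇒value-𝐈≡top value-valuation a θ a≼value) ⟩
      ∼ top                ≡⟨ ∼top≡bot ⟩
      bot                  ∎)
      where open ≡-Reasoning

    ≼⊎¬𝐈∈ : ∀ a θ → a ≼ value θ ⊎ (¬' 𝐈 a θ) ∈ x
    ≼⊎¬𝐈∈ a θ with a ≼? value θ
    ... | yes a≼value = inj₁ a≼value
    ... | no  a⋠value = inj₂ (value≡top⇒∈ (trans (value-¬ (𝐈 a θ)) (trans (cong ∼_ value-𝐈≡bot) ∼bot≡top)))
      where
      value-𝐈≡bot : value (𝐈 a θ) ≡ bot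
      value-𝐈≡bot with 𝐈-crisp value-valuation a θ
      ... | inj₁ value-𝐈≡top = ⊥-elim (a⋠value (value-𝐈≡top⇒ value-valuation a θ value-𝐈≡top))
      ... | inj₂ value-𝐈≡bot = value-𝐈≡bot

    ≼-value-≻⋀ : ∀ {e φ} χs → All (λ χ → 𝐉 e (φ ≻ χ) ∈ x) χs → e ≼ value (φ ≻ ⋀ χs)
    ≼-value-≻⋀ {e} {φ} [] [] = subst (e ≼_) (sym (Thm⇒value≡top (A3 φ))) (x≼top e)
    ≼-value-≻⋀ {e} {φ} (χ ∷ χs) (𝐉∈x ∷ 𝐉s∈x) = ≤-trans
      (subst (e ≼_) (sym (value-∧ value-valuation (φ ≻ χ) (φ ≻ ⋀ χs)))
        (∧ᵗ-glb (≤-reflexive (cong toℕ (sym (𝐉∈⇒value≡ 𝐉∈x)))) (≼-value-≻⋀ χs 𝐉s∈x)))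
      (⟶≡top⇒≼ (trans (sym (value-⇒ _ _)) (Thm⇒value≡top (A2 φ χ (⋀ χs)))))

module Lindenbaum (n : ℕ) (1≤n : 1 ≤ n) (J : Fin (suc n) → PFm) (isJ : PureSemantics.IsJOperator n J)
                  (em : ExcludedMiddle 0ℓ) where
  open LCR n J
  open ŁukasiewiczChain n
  open Valuations n 1≤n J isJ
  open IsValuation
  open Derivations n 1≤n J isJ
  open CanonicalModel n 1≤n J isJ em

  insertIf : (Δ : FmSet) (φ : Fm) → Dec (Consistent (Δ ,, φ)) → FmSet
  insertIf Δ φ (yes _) = Δ ,, φ
  insertIf Δ φ (no  _) = Δ

  ⊆-insertIf : ∀ Δ φ d → Δ ⊆ insertIf Δ φ d
  ⊆-insertIf Δ φ (yes _) _ = inj₁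
  ⊆-insertIf Δ φ (no  _) _ δ = δ

  insertIf-consistent : ∀ Δ φ d → Consistent Δ → Consistent (insertIf Δ φ d)
  insertIf-consistent Δ φ (yes consistent) _ = consistent
  insertIf-consistent Δ φ (no  _) consistent = consistent

  saturate : FmSet → List Fm → FmSet
  saturate Δ []       = Δ
  saturate Δ (φ ∷ φs) = saturate (insertIf Δ φ em) φs

  ⊆-saturate : ∀ Δ φs → Δ ⊆ saturate Δ φs
  ⊆-saturate Δ []       _ δ = δ
  ⊆-saturate Δ (φ ∷ φs) ψ δ = ⊆-saturate (insertIf Δ φ em) φs ψ (⊆-insertIf Δ φ em ψ δ)

  saturate-consistent : ∀ Δ φs → Consistent Δ → Consistent (saturate Δ φs)
  saturate-consistent Δ []       consistent = consistent
  saturate-consistent Δ (φ ∷ φs) consistent =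
    saturate-consistent (insertIf Δ φ em) φs (insertIf-consistent Δ φ em consistent)

  saturate-decides : ∀ Δ φs {φ} → φ ∈ₗ φs →
    saturate Δ φs φ ⊎ Σ FmSet (λ Δ' → Δ ⊆ Δ' × Δ' ⊆ saturate Δ φs × ¬ Consistent (Δ' ,, φ))
  saturate-decides Δ (φ ∷ φs) (here refl) with em {Consistent (Δ ,, φ)}
  ... | yes _            = inj₁ (⊆-saturate (Δ ,, φ) φs φ (inj₂ refl))
  ... | no  inconsistent = inj₂ (Δ , (λ _ δ → δ) , ⊆-saturate Δ φs , inconsistent)
  saturate-decides Δ (ψ ∷ φs) (there φ∈) with saturate-decides (insertIf Δ ψ em) φs φ∈
  ... | inj₁ added = inj₁ added
  ... | inj₂ (Δ' , Δ⊆Δ' , Δ'⊆ , inconsistent) =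
        inj₂ (Δ' , (λ χ δ → Δ⊆Δ' χ (⊆-insertIf Δ ψ em χ δ)) , Δ'⊆ , inconsistent)

  module Limit (Γ : FmSet) (Γ-consistent : Consistent Γ) where
    chain : ℕ → FmSet
    chain zero    = Γ
    chain (suc k) = saturate (chain k) (stage k)

    chain-mono : ∀ {k k'} → k ≤ k' → chain k ⊆ chain k'
    chain-mono k≤k' = go (≤⇒≤′ k≤k')
      where
      go : ∀ {k k'} → k ≤′ k' → chain k ⊆ chain k'
      go (≤′-reflexive refl)         _ γ = γ
      go (≤′-step {k'} k≤′k')        ψ γ = ⊆-saturate (chain k') (stage k') ψ (go k≤′k' ψ γ)

    chain-consistent : ∀ k → Consistent (chain k)
    chain-consistent zero    = Γ-consistent
    chain-consistent (suc k) = saturate-consistent (chain k) (stage k) (chain-consistent k)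

    limit : FmSet
    limit ψ = Σ ℕ λ k → chain k ψ

    finite⊆chain : ∀ L → All limit L → Σ ℕ λ k → All (chain k) L
    finite⊆chain []      []                 = 0 , []
    finite⊆chain (ψ ∷ L) ((i , ψ∈) ∷ L⊆) with finite⊆chain L L⊆
    ... | j , L⊆chain = i ⊔ j , chain-mono (m≤m⊔n i j) ψ ψ∈ ∷ All.map (chain-mono (m≤n⊔m i j) _) L⊆chain

    limit-consistent : Consistent limit
    limit-consistent = ⊬⊥ᶠ⇒Consistent λ limit⊢⊥ →
      let L , L⊆ , L⊢⊥ = ⊢-compact limit⊢⊥
          k , L⊆chain   = finite⊆chain L L⊆
      in Consistent⇒⊬⊥ᶠ (chain-consistent k) (⊢-mono (λ _ → All.lookup L⊆chain) L⊢⊥)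

    ∉limit⇒inconsistent : ∀ {φ} → ¬ limit φ → ¬ Consistent (limit ,, φ)
    ∉limit⇒inconsistent {φ} φ∉ consistent with stage-complete φ
    ... | k , φ∈stage with saturate-decides (chain k) (stage k) φ∈stage
    ... | inj₁ added = φ∉ (suc k , added)
    ... | inj₂ (Δ' , _ , Δ'⊆ , inconsistent) = inconsistent (Consistent-antimono Δ',φ⊆ consistent)
      where
      Δ',φ⊆ : (Δ' ,, φ) ⊆ (limit ,, φ)
      Δ',φ⊆ ψ (inj₁ δ)    = inj₁ (suc k , Δ'⊆ ψ δ)
      Δ',φ⊆ ψ (inj₂ ψ≡φ)  = inj₂ ψ≡φ

    limit-closed : ∀ {φ} → limit ⊢ φ → limit φ
    limit-closed {φ} limit⊢φ with em {limit φ}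
    ... | yes φ∈ = φ∈
    ... | no  φ∉ = ⊥-elim (Consistent⇒⊬⊥ᶠ limit-consistent (⊢-cut derive (¬Consistent⇒⊢⊥ᶠ (∉limit⇒inconsistent φ∉))))
      where
      derive : ∀ ψ → (limit ,, φ) ψ → limit ⊢ ψ
      derive ψ (inj₁ ψ∈)   = hyp ψ∈
      derive ψ (inj₂ refl) = limit⊢φ

    limit-maximal : ∀ (Δ : FmSet) → limit ⊆ Δ → ¬ (Δ ⊆ limit) → ¬ Consistent Δ
    limit-maximal Δ limit⊆Δ Δ⊈limit Δ-consistent = Δ⊈limit Δ⊆limit
      where
      Δ⊆limit : Δ ⊆ limit
      Δ⊆limit φ φ∈Δ with em {limit φ}
      ... | yes φ∈ = φ∈
      ... | no  φ∉ = ⊥-elim (∉limit⇒inconsistent φ∉ (Consistent-antimono limit,φ⊆Δ Δ-consistent))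
        where
        limit,φ⊆Δ : (limit ,, φ) ⊆ Δ
        limit,φ⊆Δ ψ (inj₁ ψ∈)   = limit⊆Δ ψ ψ∈
        limit,φ⊆Δ ψ (inj₂ refl) = φ∈Δ

    world : Wᶜ
    world = limit , limit-consistent , (λ φ → hyp , limit-closed) , limit-maximal

    Γ⊆world : Γ ⊆ proj₁ world
    Γ⊆world ψ γ = 0 , γ

  lindenbaum : ∀ Γ → Consistent Γ → Σ Wᶜ λ y → Γ ⊆ proj₁ y
  lindenbaum Γ Γ-consistent = Limit.world Γ Γ-consistent , Limit.Γ⊆world Γ Γ-consistent

  -- A non-theorem θ is refuted in a world containing ¬𝐉₁(θ).
  Thm-complete : ∀ θ → (∀ y → θ ∈ y) → Thm θ
  Thm-complete θ θ∈all with em {Thm θ}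
  ... | yes ⊢θ = ⊢θ
  ... | no  ⊬θ = ⊥-elim (top≢bot (begin
    top                            ≡⟨ World.∈⇒value≡top y (Γ⊆y β (inj₂ refl)) ⟨
    World.value y β                ≡⟨ World.value-¬ y (𝐉 top θ) ⟩
    ∼ World.value y (𝐉 top θ)      ≡⟨ cong ∼_ (≡⇒value-𝐉≡top (World.value-valuation y) top θ (World.∈⇒value≡top y (θ∈all y))) ⟩
    ∼ top                          ≡⟨ ∼top≡bot ⟩
    bot                            ∎))
    where
    open ≡-Reasoning
    β = ¬' 𝐉 top θ
    ¬β⇒θ : Valid (¬' β ⇒ θ)
    ¬β⇒θ w w-val with 𝐉-crisp w-val top θ
    ... | inj₁ w𝐉≡top = trans (⇒-homo w-val _ _)
          (trans (cong (w (¬' β) ⟶_) (value-𝐉≡top⇒ w-val top θ w𝐉≡top)) (x⟶top≡top (w (¬' β))))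
    ... | inj₂ w𝐉≡bot = trans (⇒-homo w-val _ _) (trans (cong (_⟶ w θ) w¬β≡bot) (bot⟶x≡top (w θ)))
      where
      w¬β≡bot : w (¬' β) ≡ bot
      w¬β≡bot = begin
        w (¬' β)             ≡⟨ trans (¬-homo w-val β) (cong ∼_ (¬-homo w-val _)) ⟩
        ∼ ∼ w (𝐉 top θ)      ≡⟨ ∼-involutive _ ⟩
        w (𝐉 top θ)          ≡⟨ w𝐉≡bot ⟩
        bot                  ∎
    β-consistent : Consistent (∅ ,, β)
    β-consistent = ⊬⊥ᶠ⇒Consistent λ β⊢⊥ → ⊬θ (∅⊢⇒Thm
      (valid-mp ¬β⇒θ (valid-mp (valid-¬-intro β) (deduction-crisp (λ w w-val → ¬-crisp w-val _ (𝐉-crisp w-val top θ)) β⊢⊥))))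
    y = proj₁ (lindenbaum (∅ ,, β) β-consistent)
    Γ⊆y = proj₂ (lindenbaum (∅ ,, β) β-consistent)

module TruthLemma (n : ℕ) (1≤n : 1 ≤ n) (J : Fin (suc n) → PFm) (isJ : PureSemantics.IsJOperator n J)
                  (em : ExcludedMiddle 0ℓ) where
  open LCR n J
  open ŁukasiewiczChain n
  open Valuations n 1≤n J isJ
  open Derivations n 1≤n J isJ
  open CanonicalModel n 1≤n J isJ em
  open Lindenbaum n 1≤n J isJ em
  open World using (value)

  Rᶜ-arrows : Wᶜ → Fm → Wᶜ → 𝓣 → Set
  Rᶜ-arrows x φ y c = Σ Fm λ χ → Σ 𝓣 λ e → Σ 𝓣 λ f → (𝐉 e (φ ≻ χ) ∈ x) × (𝐉 f χ ∈ y) × (c ≡ (e ⟶ f))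

  ≻-candidates : Wᶜ → Fm → Fm → 𝓣 → Set₁
  ≻-candidates x φ ψ e = Σ Wᶜ λ y → Σ 𝓣 λ r → Σ 𝓣 λ v → Rᶜ x φ y r × V y ψ v × Lift (lsuc 0ℓ) (e ≡ (r ⟶ v))

  -- When c = V_x(φ ≻ ψ) < 1, some world y has (xRᶜy → V_y(ψ)) ≤ c. With c⁺ = c + 1/(m-1), such a y
  -- must contain, for some b, all 𝐈_{e⊙b}(χ) with 𝐉_e(φ ≻ χ) ∈ x and ¬𝐈_{c⁺⊙b}(ψ); if no b admits
  -- such a world, the rule R_{c⁺} forces c⁺ ≤ c.
  module ≻-Witness (x : Wᶜ) (φ ψ : Fm) (ψ-truth : ∀ y v → value y ψ ≡ v → V y ψ v)
                   (c≢top : value x (φ ≻ ψ) ≢ top) where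
    c : 𝓣
    c = value x (φ ≻ ψ)

    c<n : suc (toℕ c) ≤ n
    c<n = ≤∧≢⇒< (toℕ≤n c) (λ c≡n → c≢top (toℕ-injective (trans c≡n (sym toℕ-top))))

    c⁺ : 𝓣
    c⁺ = fromℕ< (s≤s c<n)

    toℕ-c⁺ : toℕ c⁺ ≡ suc (toℕ c)
    toℕ-c⁺ = toℕ-fromℕ< (s≤s c<n)

    Witnesses : 𝓣 → FmSet
    Witnesses b θ = (Σ Fm λ χ → Σ 𝓣 λ e → (𝐉 e (φ ≻ χ) ∈ x) × (θ ≡ 𝐈 (e ⊙ b) χ)) ⊎ (θ ≡ ¬' 𝐈 (c⁺ ⊙ b) ψ)

    consistent⇒candidate≼c : ∀ b → Consistent (Witnesses b) → Σ 𝓣 λ e → ≻-candidates x φ ψ e × e ≼ c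
    consistent⇒candidate≼c b consistent =
      (r ⟶ v) , (y , r , v , r-meet , ψ-truth y v refl , lift refl) , ≤-trans (⟶-antitoneˡ b≼r) b⟶v≼c
      where
      y = proj₁ (lindenbaum (Witnesses b) consistent)
      Witnesses⊆y = proj₂ (lindenbaum (Witnesses b) consistent)
      r = proj₁ (meet-exists em (Rᶜ-arrows x φ y))
      r-meet = proj₂ (meet-exists em (Rᶜ-arrows x φ y))
      v = value y ψ
      b≼r : b ≼ r
      b≼r = proj₂ r-meet b λ { _ (χ , e , f , 𝐉e∈x , 𝐉f∈y , refl) →
        +≤⇒≼⟶ {b} {e} {f} (subst (_≤ n + toℕ f) (+-comm (toℕ e) (toℕ b))
          (⊙≼⇒+≤ {e} {b} {f} (subst ((e ⊙ b) ≼_) (World.𝐉∈⇒value≡ y 𝐉f∈y)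
            (value-𝐈≡top⇒ (World.value-valuation y) (e ⊙ b) χ
              (World.∈⇒value≡top y (Witnesses⊆y _ (inj₁ (χ , e , 𝐉e∈x , refl)))))))) }
      b⟶v≼c : (b ⟶ v) ≼ c
      b⟶v≼c = +≤⇒⟶≼ (≤-pred (subst (suc (n + toℕ v) ≤_) (cong (_+ toℕ b) toℕ-c⁺)
        (≰⇒> (World.¬𝐈∈⇒⋠ y (Witnesses⊆y _ (inj₂ refl)) ∘ +≤⇒⊙≼ {c⁺} {b} {v}))))

    record Conditional : Set where
      constructor conditional
      field
        consequent : Fm
        degree     : 𝓣
        𝐉-degree-∈ : 𝐉 degree (φ ≻ consequent) ∈ x
    open Conditional

    conditionalsIn : ∀ b (L : List Fm) → All (Witnesses b) L → List Conditional
    conditionalsIn b []      []                            = []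
    conditionalsIn b (θ ∷ L) (inj₁ (χ , e , 𝐉∈x , _) ∷ L⊆) = conditional χ e 𝐉∈x ∷ conditionalsIn b L L⊆
    conditionalsIn b (θ ∷ L) (inj₂ _ ∷ L⊆)                 = conditionalsIn b L L⊆

    witnesses-∈ : ∀ y b (L : List Fm) (L⊆ : All (Witnesses b) L) → (¬' 𝐈 (c⁺ ⊙ b) ψ) ∈ y →
                  (∀ {κ} → κ ∈ₗ conditionalsIn b L L⊆ → 𝐈 (degree κ ⊙ b) (consequent κ) ∈ y) → All (_∈ y) L
    witnesses-∈ y b []      []                            ¬𝐈∈y 𝐈s∈y = []
    witnesses-∈ y b (θ ∷ L) (inj₁ (χ , e , _ , refl) ∷ L⊆) ¬𝐈∈y 𝐈s∈y =
      𝐈s∈y (here refl) ∷ witnesses-∈ y b L L⊆ ¬𝐈∈y (𝐈s∈y ∘ there)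
    witnesses-∈ y b (θ ∷ L) (inj₂ refl ∷ L⊆)               ¬𝐈∈y 𝐈s∈y = ¬𝐈∈y ∷ witnesses-∈ y b L L⊆ ¬𝐈∈y 𝐈s∈y

    module AllInconsistent (inconsistent : ∀ b → ¬ Consistent (Witnesses b)) where
      refutation : ∀ b → Σ (List Fm) λ L → All (Witnesses b) L × ((_∈ₗ L) ⊢ ⊥ᶠ)
      refutation b = ⊢-compact (¬Consistent⇒⊢⊥ᶠ (inconsistent b))

      used : 𝓣 → List Conditional
      used b = conditionalsIn b (proj₁ (refutation b)) (proj₁ (proj₂ (refutation b)))

      allUsed : List Conditional
      allUsed = concatMap used (allFin (suc n))

      γ : Fin (suc n) → Fm
      γ j = ⋀ (map consequent (filter (λ κ → degree κ ≟ᵗ aᵢ j) allUsed))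

      aᵢ≼value-≻γ : ∀ j → aᵢ j ≼ value x (φ ≻ γ j)
      aᵢ≼value-≻γ j = World.≼-value-≻⋀ x _ (AllP.map⁺ (All.map
        (λ {κ} degree≡ → subst (λ e → 𝐉 e (φ ≻ consequent κ) ∈ x) degree≡ (𝐉-degree-∈ κ))
        (AllP.all-filter (λ κ → degree κ ≟ᵗ aᵢ j) allUsed)))

      -- j = opposite (degree κ) is the index with aᵢ j = degree κ, and γ j is a conjunction containing κ's consequent.
      𝐈-used-∈ : ∀ b y → All (λ h → value y h ≡ top) (overIdx (λ j → 𝐈 (aᵢ j ⊙ b) (γ j))) →
                 ∀ {κ} → κ ∈ₗ used b → 𝐈 (degree κ ⊙ b) (consequent κ) ∈ y
      𝐈-used-∈ b y antecedents {κ} κ∈ = World.value≡top⇒∈ y (≼⇒value-𝐈≡top y-val (degree κ ⊙ b) (consequent κ)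
        (≤-trans (subst (λ e → (e ⊙ b) ≼ value y (γ j)) (opposite-involutive (degree κ))
                   (value-𝐈≡top⇒ y-val (aᵢ j ⊙ b) (γ j)
                     (All.lookup (AllP.map⁻ {xs = allFin (suc n)} antecedents) (∈-allFin j))))
                 (value-⋀≼ y-val (∈-map⁺ consequent
                   (∈-filter⁺ (λ κ → degree κ ≟ᵗ aᵢ j) (∈-concatMap⁺ used (lose (∈-allFin b) κ∈))
                     (sym (opposite-involutive (degree κ))))))))
        where
        j = opposite (degree κ)
        y-val = World.value-valuation y

      Rₐ-conclusion : ∀ b y → All (λ h → value y h ≡ top) (overIdx (λ j → 𝐈 (aᵢ j ⊙ b) (γ j))) →
                      value y (𝐈 (c⁺ ⊙ b) ψ) ≡ top
      Rₐ-conclusion b y antecedents with World.≼⊎¬𝐈∈ y (c⁺ ⊙ b) ψ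
      ... | inj₁ c⁺⊙b≼ = ≼⇒value-𝐈≡top (World.value-valuation y) (c⁺ ⊙ b) ψ c⁺⊙b≼
      ... | inj₂ ¬𝐈∈y = ⊥-elim (World.⊬⊥ᶠ y (⊢-mono (λ _ → All.lookup refutation⊆y) (proj₂ (proj₂ (refutation b)))))
        where
        refutation⊆y = witnesses-∈ y b (proj₁ (refutation b)) (proj₁ (proj₂ (refutation b))) ¬𝐈∈y (𝐈-used-∈ b y antecedents)

      Rₐ-premise : ∀ b → Thm (iterImp (overIdx (λ j → 𝐈 (aᵢ j ⊙ b) (γ j))) (𝐈 (c⁺ ⊙ b) ψ))
      Rₐ-premise b = Thm-complete _ λ y → World.value≡top⇒∈ y (iterImp-intro (World.value-valuation y)
        (overIdx (λ j → 𝐈 (aᵢ j ⊙ b) (γ j))) (𝐈 (c⁺ ⊙ b) ψ)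
        (AllP.map⁺ (All.universal (λ j → 𝐈-crisp (World.value-valuation y) (aᵢ j ⊙ b) (γ j)) (allFin (suc n))))
        (Rₐ-conclusion b y))

      absurd : ⊥
      absurd = <-irrefl refl (subst (_≤ toℕ c) toℕ-c⁺ c⁺≼c)
        where
        x-val = World.value-valuation x
        c⁺≼c : c⁺ ≼ c
        c⁺≼c = value-𝐈≡top⇒ x-val c⁺ (φ ≻ ψ)
          (iterImp-elim x-val (overIdx (λ j → 𝐈 (aᵢ j) (φ ≻ γ j))) (𝐈 c⁺ (φ ≻ ψ))
            (World.Thm⇒value≡top x (Rₐ c⁺ φ γ ψ Rₐ-premise))
            (AllP.map⁺ (All.universal (λ j → ≼⇒value-𝐈≡top x-val (aᵢ j) (φ ≻ γ j) (aᵢ≼value-≻γ j)) (allFin (suc n)))))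

    candidate≼c : Σ 𝓣 λ e → ≻-candidates x φ ψ e × e ≼ c
    candidate≼c with em {Σ 𝓣 λ b → Consistent (Witnesses b)}
    ... | yes (b , consistent) = consistent⇒candidate≼c b consistent
    ... | no  none             = ⊥-elim (AllInconsistent.absurd (λ b consistent → none (b , consistent)))

  value-≻-IsMeet : ∀ x φ ψ → (∀ y v → V y ψ v → value y ψ ≡ v) → (∀ y v → value y ψ ≡ v → V y ψ v) →
                   IsMeet (≻-candidates x φ ψ) (value x (φ ≻ ψ))
  value-≻-IsMeet x φ ψ V⇒value value⇒V = lower-bound , greatest
    where
    c = value x (φ ≻ ψ)
    -- c → v is one of the arrows whose meet is r, so r ≤ c → v.
    lower-bound : ∀ e → ≻-candidates x φ ψ e → c ≼ e
    lower-bound _ (y , r , v , r-meet , Vyψv , lift refl) =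
      +≤⇒≼⟶ {c} {r} {v} (subst (_≤ n + toℕ v) (+-comm (toℕ r) (toℕ c))
        (≼⟶⇒+≤ {r} {c} {v} (proj₁ r-meet _
          (ψ , c , v , World.𝐉-value-∈ x (φ ≻ ψ) , World.value≡⇒𝐉∈ y (V⇒value y v Vyψv) , refl))))
    greatest : ∀ d → (∀ e → ≻-candidates x φ ψ e → d ≼ e) → d ≼ c
    greatest d d-lb with c ≟ᵗ top
    ... | yes c≡top = subst (d ≼_) (sym c≡top) (x≼top d)
    ... | no  c≢top with ≻-Witness.candidate≼c x φ ψ value⇒V c≢top
    ...   | e , candidate , e≼c = ≤-trans (d-lb e candidate) e≼c

  truth : ∀ φ x a → (V x φ a → value x φ ≡ a) × (value x φ ≡ a → V x φ a)
  truth (var p) x a = World.𝐉∈⇒value≡ x ∘ lower , lift ∘ World.value≡⇒𝐉∈ x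
  truth (¬' φ) x a =
    (λ { (b , Vxφb , lift a≡∼b) → trans (World.value-¬ x φ) (trans (cong ∼_ (proj₁ (truth φ x b) Vxφb)) (sym a≡∼b)) }) ,
    (λ value≡a → value x φ , proj₂ (truth φ x _) refl , lift (trans (sym value≡a) (World.value-¬ x φ)))
  truth (φ ⇒ ψ) x a =
    (λ { (b , c , Vxφb , Vxψc , lift a≡b⟶c) → trans (World.value-⇒ x φ ψ)
           (trans (cong₂ _⟶_ (proj₁ (truth φ x b) Vxφb) (proj₁ (truth ψ x c) Vxψc)) (sym a≡b⟶c)) }) ,
    (λ value≡a → value x φ , value x ψ , proj₂ (truth φ x _) refl , proj₂ (truth ψ x _) refl ,
                 lift (trans (sym value≡a) (World.value-⇒ x φ ψ)))
  truth (φ ≻ ψ) x a = IsMeet-unique meet , λ value≡a → subst (IsMeet _) value≡a meet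
    where
    meet = value-≻-IsMeet x φ ψ (λ y v → proj₁ (truth ψ y v)) (λ y v → proj₂ (truth ψ y v))

-- Excluded middle for small types suffices.
lemma2p17 : (n : ℕ) → 1 ≤ n → (J : Fin (Data.Nat.suc n) → PFm) → PureSemantics.IsJOperator n J →
    ExcludedMiddle 0ℓ → ExcludedMiddle (lsuc 0ℓ) →
      ∀ (φ : Fm) (x : LCR.Wᶜ n J) (a : Fin (Data.Nat.suc n)) →
        (LCR.V n J x φ a → LCR._∈_ n J (LCR.𝐉 n J a φ) x) × (LCR._∈_ n J (LCR.𝐉 n J a φ) x → LCR.V n J x φ a)
lemma2p17 n 1≤n J isJ em _ φ x a =
  World.value≡⇒𝐉∈ x ∘ proj₁ (truth φ x a) , proj₂ (truth φ x a) ∘ World.𝐉∈⇒value≡ x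
  where
  open TruthLemma n 1≤n J isJ em
  open CanonicalModel n 1≤n J isJ em
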